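{- For every integer $n\geq 0$ there exists an involution $\kappa$ on $\mathcal{LB}_{2n+1}$ such that (i) $\kappa(T)=T$ if and only if $T\in\mathcal{IB}_{2n+1}$, and (ii) $(-1)^{\mathsf{h}(T)}+(-1)^{\mathsf{h}(\kappa(T))}=0$ for every $T\in\mathcal{LB}_{2n+1}\setminus\mathcal{IB}_{2n+1}$.
   Context: A word $w=w_1\cdots w_j$ with distinct letters is unimodal if $w_1<\cdots<w_m>w_{m+1}>\cdots>w_j$ for some $1\le m\le j$; it is an odd unimodal permutation if moreover $j$ is odd. A complete binary tree is a rooted (plane) tree in which every internal node has a left child and a right child. A labeled binary tree on $[2n+1]$ is a complete binary tree whose nodes are labeled by odd unimodal permutations such that the sets of letters of all labels form a set partition of $[2n+1]$. $\mathcal{LB}_{2n+1}$ is the set of all labeled binary trees on $[2n+1]$, and for $T\in\mathcal{LB}_{2n+1}$, $\mathsf{h}(T)$ is half the number of edges of $T$. A complete increasing binary tree on $[2n+1]$ is a complete binary tree whose nodes are labeled by single elements of $[2n+1]$, each element used exactly once, such that labels increase along every path from the root to a leaf; $\mathcal{IB}_{2n+1}\subseteq\mathcal{LB}_{2n+1}$ denotes the set of these trees (viewing each single letter as an odd unimodal permutation of length one). -}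

module Defs where

open import Data.Nat using (ℕ; zero; suc; _+_; _*_; _∸_; _<_; _>_; _≤_; _/_)
open import Data.List using (List; []; _∷_; length; take; drop; map; upTo; _++_)
open import Data.List.Relation.Unary.Linked using (Linked)
open import Data.List.Relation.Unary.Unique.Propositional using (Unique)
open import Data.List.Relation.Binary.Permutation.Propositional using (_↭_)
open import Data.Product using (Σ; ∃; _×_; _,_; proj₁)
open import Relation.Binary.PropositionalEquality using (_≡_)
open import Data.Unit using (⊤)
open import Data.Empty using (⊥)

data BTree (A : Set) : Set where
  leaf : A → BTree A
  node : A → BTree A → BTree A → BTree A

Word : Set
Word = List ℕ

-- Unimodal (for a word with distinct letters):
-- w₁ < ⋯ < w_m > w_{m+1} > ⋯ > w_j for some 1 ≤ m ≤ j.
Unimodal : Word → Set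
Unimodal w = Σ ℕ λ m → (1 ≤ m) × (m ≤ length w)
  × Linked _<_ (take m w) × Linked _>_ (drop (m ∸ 1) w)

OddLength : Word → Set
OddLength w = Σ ℕ λ k → length w ≡ suc (2 * k)

OddUnimodal : Word → Set
OddUnimodal w = Unique w × Unimodal w × OddLength w

labels : {A : Set} → BTree A → List A
labels (leaf a) = a ∷ []
labels (node a l r) = a ∷ (labels l ++ labels r)

letters : BTree Word → List ℕ
letters (leaf w) = w
letters (node w l r) = w ++ (letters l ++ letters r)

AllNodes : {A : Set} → (A → Set) → BTree A → Set
AllNodes P (leaf a) = P a
AllNodes P (node a l r) = P a × AllNodes P l × AllNodes P r

interval : ℕ → List ℕ
interval m = map suc (upTo m)

-- Labeled binary tree on [2n+1]: every label is an odd unimodal permutation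
-- and the letter sets of the labels form a set partition of [2n+1]
-- (labels are nonempty since of odd length; the concatenation of all labels
-- is a permutation of 1,…,2n+1, i.e. the letter sets are disjoint and cover).
IsLB : ℕ → BTree Word → Set
IsLB n T = AllNodes OddUnimodal T × (letters T ↭ interval (suc (2 * n)))

LB : ℕ → Set
LB n = Σ (BTree Word) (IsLB n)

rootLabel : {A : Set} → BTree A → A
rootLabel (leaf a) = a
rootLabel (node a l r) = a

Increasing : BTree Word → Set
Increasing (leaf (x ∷ [])) = ⊤
Increasing (node (x ∷ []) l r) =
  (Σ ℕ λ y → rootLabel l ≡ y ∷ [] × x < y) ×
  (Σ ℕ λ z → rootLabel r ≡ z ∷ [] × x < z) ×
  Increasing l × Increasing r
Increasing _ = ⊥

edges : {A : Set} → BTree A → ℕ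
edges (leaf a) = 0
edges (node a l r) = 2 + edges l + edges r

h : {A : Set} → BTree A → ℕ
h T = edges T / 2

-- Let m be the least letter of T. If the root of T is labelled [m], κ recurses into the first subtree
-- that is not increasing, and fixes T when there is none, i.e. when T is increasing. Otherwise φ m
-- pairs T with a tree whose root is not [m] either and which has one internal node more or less, so
-- that h changes parity. A root label m v z (or x v m) splits into a root v whose children are the
-- old tree relabelled [m] and a new leaf [z] (or [x]); conversely, when [m] is a child of the root v
-- and its sibling is a leaf [z] with v z unimodal, the two merge back into m v z. If instead the
-- sibling of [m] is increasing, v trades two letters with it: the sibling's nearest leaf s and its
-- parent p are appended to v when v s is unimodal, and otherwise the last two letters of v are hung
-- back onto the sibling as such a leaf and parent. These two moves undo each other because p < s and
-- p lies below the new nearest leaf, so v s p followed by that leaf has a valley. A non-increasing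
-- sibling is handled by κ itself, and when m lies deeper, φ descends towards it.

module Submission where

open import Defs
open import Data.Nat using (ℕ)
open import Data.Integer using (ℤ; -1ℤ; _^_; _+_; 0ℤ)
open import Data.Product using (Σ; _×_; proj₁)
open import Relation.Binary.PropositionalEquality using (_≡_)
open import Relation.Nullary using (¬_)
open import Function using (_⇔_)

open import Data.Empty using (⊥-elim)
import Data.Integer.Properties as ℤ
open import Data.List using (List; []; _∷_; initLast; _∷ʳ′_; _++_; _∷ʳ_; [_]; length; reverse)
import Data.List.Extrema.Nat as Extrema
open import Data.List.Membership.Propositional using (_∈_; _∉_)
open import Data.List.Membership.Propositional.Properties using (∈-++⁺ˡ; ∈-++⁺ʳ; ∈-++⁻)
open import Data.List.Properties
  using (++-conicalˡ; ∷-injectiveʳ; ≡-dec; reverse-++; ++-identityʳ; ++-assoc; unfold-reverse; reverse-involutive; length-reverse)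
open import Data.List.Relation.Binary.Permutation.Propositional using (_↭_; ↭-swap; ↭-prep; ↭-refl; ↭-sym; ↭-trans; ↭⇒↭ₛ)
open import Data.List.Relation.Binary.Permutation.Propositional.Properties
  using (All-resp-↭; ∈-resp-↭; ++⁺; ++⁺ˡ; ++⁺ʳ; ↭-reverse; ++-commutativeMonoid)
import Data.List.Relation.Binary.Permutation.Setoid.Properties as ↭ₛ
open import Algebra.Solver.CommutativeMonoid (++-commutativeMonoid {A = ℕ}) using (solve; _⊜_; _⊕_)
open import Data.List.Relation.Unary.All as All using (All; []; _∷_)
import Data.List.Relation.Unary.All.Properties as AllP
open import Data.List.Relation.Unary.Any using (here; there)
open import Data.List.Relation.Unary.Linked as Linked using (Linked; []; [-]; _∷_)
open import Data.List.Relation.Unary.Unique.Propositional using (Unique; []; _∷_)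
import Data.List.Relation.Unary.Unique.Propositional.Properties as UniqueProps
open import Data.Nat as ℕ using (zero; suc; _<_; _>_; _≤_; _<?_; _≟_; z≤n; s≤s)
open import Data.List.Membership.DecPropositional _≟_ using (_∈?_)
open import Data.Nat.DivMod using (m*n/n≡m)
open import Data.Nat.Properties
  using (suc-injective; 1+n≢n; *-distribʳ-+; +-identityʳ; +-comm; +-suc; ≤-refl; ≤-antisym; <⇒≤; ≮⇒≥; ≤∧≢⇒<;
         <-asym; <-irrefl; <-trans; <-cmp; ≤-<-trans)
open import Data.Product using (_,_; proj₂)
import Data.Product as Product
open import Data.Sum using (_⊎_; inj₁; inj₂)
open import Data.Unit using (tt)
open import Function using (id; flip; _∘_; _⟨_⟩_; mk⇔)
open import Relation.Binary.Definitions using (tri<; tri≈; tri>)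
open import Relation.Binary.PropositionalEquality
  using (_≢_; refl; sym; trans; cong; cong₂; subst; subst₂; module ≡-Reasoning)
open import Relation.Binary.PropositionalEquality.Properties using (setoid)
open import Relation.Nullary using (Dec; yes; no)
import Relation.Nullary.Decidable as Dec
open import Relation.Nullary.Decidable using (_×-dec_)

-- `first` and `last` are only applied to nonempty words; on [] they return 0.
first : List ℕ → ℕ
first [] = 0
first (x ∷ _) = x

last : List ℕ → ℕ
last [] = 0
last (x ∷ []) = x
last (_ ∷ y ∷ ys) = last (y ∷ ys)

dropLast : List ℕ → List ℕ
dropLast [] = []
dropLast (x ∷ []) = []
dropLast (x ∷ y ∷ ys) = x ∷ dropLast (y ∷ ys)

interior : Word → Word
interior [] = []
interior (_ ∷ xs) = dropLast xs

last-∷ʳ : ∀ xs x → last (xs ∷ʳ x) ≡ x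
last-∷ʳ [] x = refl
last-∷ʳ (y ∷ []) x = refl
last-∷ʳ (y ∷ z ∷ ys) x = last-∷ʳ (z ∷ ys) x

dropLast-∷ʳ : ∀ xs x → dropLast (xs ∷ʳ x) ≡ xs
dropLast-∷ʳ [] x = refl
dropLast-∷ʳ (y ∷ []) x = refl
dropLast-∷ʳ (y ∷ z ∷ ys) x = cong (y ∷_) (dropLast-∷ʳ (z ∷ ys) x)

dropLast-∷ʳ-last : ∀ x xs → x ∷ xs ≡ dropLast (x ∷ xs) ∷ʳ last (x ∷ xs)
dropLast-∷ʳ-last x [] = refl
dropLast-∷ʳ-last x (y ∷ ys) = cong (x ∷_) (dropLast-∷ʳ-last y ys)

last-∈ : ∀ x xs → last (x ∷ xs) ∈ x ∷ xs
last-∈ x [] = here refl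
last-∈ x (y ∷ ys) = there (last-∈ y ys)

last-reverse : ∀ x xs → last (reverse (x ∷ xs)) ≡ x
last-reverse x xs = trans (cong last (unfold-reverse x xs)) (last-∷ʳ (reverse xs) x)

∷ʳ-≢-[] : ∀ (xs : List ℕ) x → xs ∷ʳ x ≢ []
∷ʳ-≢-[] [] x ()
∷ʳ-≢-[] (_ ∷ _) x ()

reverse-≢-[] : ∀ (x : ℕ) xs → reverse (x ∷ xs) ≢ []
reverse-≢-[] x xs = subst (_≢ []) (sym (unfold-reverse x xs)) (∷ʳ-≢-[] (reverse xs) x)

length-∷ʳ : ∀ (xs : List ℕ) x → length (xs ∷ʳ x) ≡ suc (length xs)
length-∷ʳ [] x = refl
length-∷ʳ (y ∷ ys) x = cong suc (length-∷ʳ ys x)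

length-∷ʳ-∷ʳ : ∀ u a b → length (u ∷ʳ a ∷ʳ b) ≡ suc (suc (length u))
length-∷ʳ-∷ʳ u a b = trans (length-∷ʳ (u ∷ʳ a) b) (cong suc (length-∷ʳ u a))

++-∷ʳ-∷ʳ : ∀ u a b (xs : List ℕ) → (u ∷ʳ a ∷ʳ b) ++ xs ≡ u ++ a ∷ b ∷ xs
++-∷ʳ-∷ʳ u a b xs = trans (++-assoc (u ∷ʳ a) [ b ] xs) (++-assoc u [ a ] (b ∷ xs))

module _ {R : ℕ → ℕ → Set} where

  Linked-++⁻ˡ : ∀ xs {ys} → Linked R (xs ++ ys) → Linked R xs
  Linked-++⁻ˡ [] l = []
  Linked-++⁻ˡ (x ∷ []) l = [-]
  Linked-++⁻ˡ (x ∷ y ∷ xs) (r ∷ l) = r ∷ Linked-++⁻ˡ (y ∷ xs) l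

  Linked-∷ʳ⁺ : ∀ xs {x} → Linked R xs → R (last xs) x → Linked R (xs ∷ʳ x)
  Linked-∷ʳ⁺ [] l r = [-]
  Linked-∷ʳ⁺ (y ∷ []) l r = r ∷ [-]
  Linked-∷ʳ⁺ (y ∷ z ∷ ys) (r₀ ∷ l) r = r₀ ∷ Linked-∷ʳ⁺ (z ∷ ys) l r

  Linked-∷ʳ⁻ : ∀ y ys {x} → Linked R ((y ∷ ys) ∷ʳ x) → R (last (y ∷ ys)) x
  Linked-∷ʳ⁻ y [] (r ∷ _) = r
  Linked-∷ʳ⁻ y (z ∷ ys) (_ ∷ l) = Linked-∷ʳ⁻ z ys l

Linked-reverse : ∀ {R : ℕ → ℕ → Set} xs → Linked R xs → Linked (flip R) (reverse xs)
Linked-reverse [] l = []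
Linked-reverse (x ∷ []) l = [-]
Linked-reverse {R} (x ∷ y ∷ ys) (r ∷ l) =
  subst (Linked (flip R)) (sym (unfold-reverse x (y ∷ ys)))
    (Linked-∷ʳ⁺ (reverse (y ∷ ys)) (Linked-reverse (y ∷ ys) l)
      (subst (R x) (sym (last-reverse y ys)) r))

-- Unimodal words

data IsUnimodal : List ℕ → Set where
  falling : ∀ {x xs} → Linked _>_ (x ∷ xs) → IsUnimodal (x ∷ xs)
  rising : ∀ {x y xs} → x < y → IsUnimodal (y ∷ xs) → IsUnimodal (x ∷ y ∷ xs)

unimodal? : (w : List ℕ) → Dec (IsUnimodal w)
unimodal? [] = no λ ()
unimodal? (x ∷ []) = yes (falling [-])
unimodal? (x ∷ y ∷ xs) with x <? y | unimodal? (y ∷ xs) | Linked.linked? (flip _<?_) (x ∷ y ∷ xs)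
... | yes x<y | yes u | _ = yes (rising x<y u)
... | yes x<y | no ¬u | _ = no λ { (falling (y<x ∷ _)) → <-asym x<y y<x ; (rising _ u) → ¬u u }
... | no x≮y | _ | yes l = yes (falling l)
... | no x≮y | _ | no ¬l = no λ { (falling l) → ¬l l ; (rising x<y _) → x≮y x<y }

IsUnimodal⇒≢[] : ∀ {w} → IsUnimodal w → w ≢ []
IsUnimodal⇒≢[] (falling _) ()
IsUnimodal⇒≢[] (rising _ _) ()

IsUnimodal⇒first-∈ : ∀ {w} → IsUnimodal w → first w ∈ w
IsUnimodal⇒first-∈ (falling _) = here refl
IsUnimodal⇒first-∈ (rising _ _) = here refl

IsUnimodal⇒last-∈ : ∀ {w} → IsUnimodal w → last w ∈ w
IsUnimodal⇒last-∈ (falling {x} {xs} _) = last-∈ x xs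
IsUnimodal⇒last-∈ (rising {x} {y} {xs} _ _) = last-∈ x (y ∷ xs)

IsUnimodal-tail : ∀ {x y xs} → IsUnimodal (x ∷ y ∷ xs) → IsUnimodal (y ∷ xs)
IsUnimodal-tail (falling l) = falling (Linked.tail l)
IsUnimodal-tail (rising _ u) = u

ascending⇒IsUnimodal : ∀ {xs} → xs ≢ [] → Linked _<_ xs → IsUnimodal xs
ascending⇒IsUnimodal {[]} xs≢[] _ = ⊥-elim (xs≢[] refl)
ascending⇒IsUnimodal {x ∷ []} _ _ = falling [-]
ascending⇒IsUnimodal {x ∷ y ∷ xs} _ (x<y ∷ l) = rising x<y (ascending⇒IsUnimodal (λ ()) l)

pair-IsUnimodal : ∀ {x y} → x ≢ y → IsUnimodal (x ∷ y ∷ [])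
pair-IsUnimodal {x} {y} x≢y with <-cmp x y
... | tri< x<y _ _ = rising x<y (falling [-])
... | tri≈ _ x≡y _ = ⊥-elim (x≢y x≡y)
... | tri> _ _ y<x = falling (y<x ∷ [-])

IsUnimodal-init : ∀ xs {x} → xs ≢ [] → IsUnimodal (xs ∷ʳ x) → IsUnimodal xs
IsUnimodal-init [] xs≢[] _ = ⊥-elim (xs≢[] refl)
IsUnimodal-init (y ∷ []) _ _ = falling [-]
IsUnimodal-init (y ∷ z ∷ ys) _ (falling l) = falling (Linked-++⁻ˡ (y ∷ z ∷ ys) l)
IsUnimodal-init (y ∷ z ∷ ys) _ (rising y<z u) = rising y<z (IsUnimodal-init (z ∷ ys) (λ ()) u)

IsUnimodal-∷ʳ-fall : ∀ {xs x} → IsUnimodal xs → x < last xs → IsUnimodal (xs ∷ʳ x)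
IsUnimodal-∷ʳ-fall (falling {x₀} {xs₀} l) x<last = falling (Linked-∷ʳ⁺ (x₀ ∷ xs₀) l x<last)
IsUnimodal-∷ʳ-fall (rising x<y u) x<last = rising x<y (IsUnimodal-∷ʳ-fall u x<last)

IsUnimodal-∷ʳ-rise : ∀ xs {x} → IsUnimodal (xs ∷ʳ x) → last xs < x → Linked _<_ (xs ∷ʳ x)
IsUnimodal-∷ʳ-rise [] _ _ = [-]
IsUnimodal-∷ʳ-rise (y ∷ []) _ y<x = y<x ∷ [-]
IsUnimodal-∷ʳ-rise (y ∷ z ∷ ys) (falling l) last<x = ⊥-elim (<-asym last<x (Linked-∷ʳ⁻ y (z ∷ ys) l))
IsUnimodal-∷ʳ-rise (y ∷ z ∷ ys) (rising y<z u) last<x = y<z ∷ IsUnimodal-∷ʳ-rise (z ∷ ys) u last<x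

no-valley : ∀ xs {a b c} → b < a → b < c → ¬ IsUnimodal (xs ∷ʳ a ∷ʳ b ∷ʳ c)
no-valley [] b<a b<c (falling (_ ∷ c<b ∷ [-])) = <-asym b<c c<b
no-valley [] b<a b<c (rising a<b _) = <-asym a<b b<a
no-valley (x ∷ []) b<a b<c (rising _ u) = no-valley [] b<a b<c u
no-valley (x ∷ y ∷ xs) b<a b<c (rising _ u) = no-valley (y ∷ xs) b<a b<c u
no-valley (x ∷ xs) {a} {b} b<a b<c (falling l) =
  <-asym b<c (subst (_> _) (last-∷ʳ (x ∷ xs ∷ʳ a) b) (Linked-∷ʳ⁻ x (xs ∷ʳ a ∷ʳ b) l))

¬IsUnimodal-∷ʳ⇒valley : ∀ u a b {s} → IsUnimodal (u ∷ʳ a ∷ʳ b) → a ≢ b → b ≢ s →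
  ¬ IsUnimodal (u ∷ʳ a ∷ʳ b ∷ʳ s) → b < a × b < s
¬IsUnimodal-∷ʳ⇒valley u a b {s} uv a≢b b≢s ¬us = b<a , b<s
  where
  last≡b : last (u ∷ʳ a ∷ʳ b) ≡ b
  last≡b = last-∷ʳ (u ∷ʳ a) b
  b<s : b < s
  b<s with <-cmp b s
  ... | tri< b<s _ _ = b<s
  ... | tri≈ _ b≡s _ = ⊥-elim (b≢s b≡s)
  ... | tri> _ _ s<b = ⊥-elim (¬us (IsUnimodal-∷ʳ-fall uv (subst (s <_) (sym last≡b) s<b)))
  b<a : b < a
  b<a with <-cmp a b
  ... | tri> _ _ b<a = b<a
  ... | tri≈ _ a≡b _ = ⊥-elim (a≢b a≡b)
  ... | tri< a<b _ _ = ⊥-elim (¬us (ascending⇒IsUnimodal (∷ʳ-≢-[] (u ∷ʳ a ∷ʳ b) s)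
          (Linked-∷ʳ⁺ (u ∷ʳ a ∷ʳ b) (IsUnimodal-∷ʳ-rise (u ∷ʳ a) uv (subst (_< b) (sym (last-∷ʳ u a)) a<b))
            (subst (_< s) (sym last≡b) b<s))))

IsUnimodal-reverse : ∀ {w} → IsUnimodal w → IsUnimodal (reverse w)
IsUnimodal-reverse (falling {x} {xs} l) = ascending⇒IsUnimodal (reverse-≢-[] x xs) (Linked-reverse (x ∷ xs) l)
IsUnimodal-reverse (rising {x} {y} {xs} x<y u) =
  subst IsUnimodal (sym (unfold-reverse x (y ∷ xs)))
    (IsUnimodal-∷ʳ-fall (IsUnimodal-reverse u) (subst (x <_) (sym (last-reverse y xs)) x<y))

IsUnimodal-reverse⁻ : ∀ {w} → IsUnimodal (reverse w) → IsUnimodal w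
IsUnimodal-reverse⁻ {w} u = subst IsUnimodal (reverse-involutive w) (IsUnimodal-reverse u)

falling-min-last : ∀ {m} x xs → Linked _>_ (x ∷ xs) → m ∈ x ∷ xs → All (m ≤_) (x ∷ xs) → last (x ∷ xs) ≡ m
falling-min-last x [] _ (here refl) _ = refl
falling-min-last x (y ∷ ys) (y<x ∷ _) (here refl) (_ ∷ m≤y ∷ _) = ⊥-elim (<-irrefl refl (≤-<-trans m≤y y<x))
falling-min-last x (y ∷ ys) (_ ∷ l) (there m∈) (_ ∷ m≤) = falling-min-last y ys l m∈ m≤

IsUnimodal-min-at-end : ∀ {w m} → IsUnimodal w → m ∈ w → All (m ≤_) w → first w ≡ m ⊎ last w ≡ m
IsUnimodal-min-at-end (falling {x} {xs} l) m∈ m≤ = inj₂ (falling-min-last x xs l m∈ m≤)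
IsUnimodal-min-at-end (rising x<y u) (here refl) m≤ = inj₁ refl
IsUnimodal-min-at-end (rising x<y u) (there m∈) (m≤x ∷ m≤) with IsUnimodal-min-at-end u m∈ m≤
... | inj₁ refl = ⊥-elim (<-irrefl refl (≤-<-trans m≤x x<y))
... | inj₂ last≡m = inj₂ last≡m

IsUnimodal⇒Unimodal : ∀ {w} → IsUnimodal w → Unimodal w
IsUnimodal⇒Unimodal (falling l) = 1 , s≤s z≤n , s≤s z≤n , [-] , l
IsUnimodal⇒Unimodal (rising x<y u) with IsUnimodal⇒Unimodal u
... | suc k , _ , s≤s k≤ , asc , desc = suc (suc k) , s≤s z≤n , s≤s (s≤s k≤) , x<y ∷ asc , desc

Unimodal⇒IsUnimodal : ∀ w → Unimodal w → IsUnimodal w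
Unimodal⇒IsUnimodal [] (_ , s≤s _ , () , _)
Unimodal⇒IsUnimodal (x ∷ xs) (1 , _ , _ , _ , desc) = falling desc
Unimodal⇒IsUnimodal (x ∷ []) (suc (suc k) , _ , s≤s () , _)
Unimodal⇒IsUnimodal (x ∷ y ∷ xs) (suc (suc k) , _ , s≤s k≤ , x<y ∷ asc , desc) =
  rising x<y (Unimodal⇒IsUnimodal (y ∷ xs) (suc k , s≤s z≤n , k≤ , asc , desc))

data Odd : ℕ → Set where
  one : Odd 1
  plus-two : ∀ {n} → Odd n → Odd (suc (suc n))

Odd-pred : ∀ {n} → Odd (suc (suc n)) → Odd n
Odd-pred (plus-two o) = o

Odd⇒≢[] : ∀ {xs : List ℕ} → Odd (length xs) → xs ≢ []
Odd⇒≢[] () refl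

Odd⇒suc-2* : ∀ {n} → Odd n → Σ ℕ λ k → n ≡ suc (2 ℕ.* k)
Odd⇒suc-2* one = 0 , refl
Odd⇒suc-2* (plus-two o) with Odd⇒suc-2* o
... | k , refl = suc k , cong (suc ∘ suc) (sym (+-suc k (k ℕ.+ 0)))

Odd-suc-2* : ∀ k → Odd (suc (2 ℕ.* k))
Odd-suc-2* zero = one
Odd-suc-2* (suc k) = subst Odd (cong (suc ∘ suc) (sym (+-suc k (k ℕ.+ 0)))) (plus-two (Odd-suc-2* k))

IsOddUnimodal : Word → Set
IsOddUnimodal w = IsUnimodal w × Odd (length w)

singleton-IsOddUnimodal : ∀ x → IsOddUnimodal [ x ]
singleton-IsOddUnimodal x = falling [-] , one

IsOddUnimodal-reverse : ∀ {w} → IsOddUnimodal w → IsOddUnimodal (reverse w)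
IsOddUnimodal-reverse {w} (u , odd) = IsUnimodal-reverse u , subst Odd (sym (length-reverse w)) odd

record OuterSplit (w : Word) : Set where
  field
    shape : w ≡ first w ∷ interior w ∷ʳ last w
    interior-oddUnimodal : IsOddUnimodal (interior w)
    interior∷ʳlast-unimodal : IsUnimodal (interior w ∷ʳ last w)
    first∷interior-unimodal : IsUnimodal (first w ∷ interior w)

outerSplit : ∀ {w} → IsOddUnimodal w → (∀ x → w ≢ [ x ]) → OuterSplit w
outerSplit {[]} (() , _) _
outerSplit {x ∷ []} _ w≢[x] = ⊥-elim (w≢[x] x refl)
outerSplit {x ∷ y ∷ ys} (u , plus-two odd) _ = record
  { shape = shape
  ; interior-oddUnimodal = IsUnimodal-init v (Odd⇒≢[] odd-v) vz , odd-v
  ; interior∷ʳlast-unimodal = vz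
  ; first∷interior-unimodal = IsUnimodal-init (x ∷ v) (λ ()) (subst IsUnimodal shape u) }
  where
  v = dropLast (y ∷ ys)
  z = last (y ∷ ys)
  shape : x ∷ y ∷ ys ≡ x ∷ v ∷ʳ z
  shape = cong (x ∷_) (dropLast-∷ʳ-last y ys)
  vz : IsUnimodal (v ∷ʳ z)
  vz = subst IsUnimodal (dropLast-∷ʳ-last y ys) (IsUnimodal-tail u)
  odd-v : Odd (length v)
  odd-v = subst Odd (cong ℕ.pred (trans (cong length (dropLast-∷ʳ-last y ys)) (length-∷ʳ v z))) odd

-- Distinct letters and the least letter

Unique-resp-↭ : ∀ {xs ys : List ℕ} → xs ↭ ys → Unique xs → Unique ys
Unique-resp-↭ xs↭ys = ↭ₛ.Unique-resp-↭ (setoid ℕ) (↭⇒↭ₛ xs↭ys)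

Unique-++⁻ˡ : ∀ (xs : List ℕ) {ys} → Unique (xs ++ ys) → Unique xs
Unique-++⁻ˡ [] _ = []
Unique-++⁻ˡ (x ∷ xs) (x∉ ∷ u) = AllP.++⁻ˡ xs x∉ ∷ Unique-++⁻ˡ xs u

Unique-++⁻ʳ : ∀ (xs : List ℕ) {ys} → Unique (xs ++ ys) → Unique ys
Unique-++⁻ʳ [] u = u
Unique-++⁻ʳ (x ∷ xs) (_ ∷ u) = Unique-++⁻ʳ xs u

Unique-++⇒∉ : ∀ (xs : List ℕ) {ys z} → Unique (xs ++ ys) → z ∈ xs → z ∉ ys
Unique-++⇒∉ (x ∷ xs) (x∉ ∷ _) (here refl) z∈ys = All.lookup (AllP.++⁻ʳ xs x∉) z∈ys refl
Unique-++⇒∉ (x ∷ xs) (_ ∷ u) (there z∈xs) z∈ys = Unique-++⇒∉ xs u z∈xs z∈ys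

Unique-++⇒≢ : ∀ (xs : List ℕ) {ys a b} → Unique (xs ++ ys) → a ∈ xs → b ∈ ys → a ≢ b
Unique-++⇒≢ xs u a∈ b∈ refl = Unique-++⇒∉ xs u a∈ b∈

Unique-interval : ∀ k → Unique (interval k)
Unique-interval k = UniqueProps.map⁺ suc-injective (UniqueProps.upTo⁺ k)

++-swapˡ : ∀ (xs ys zs : List ℕ) → xs ++ ys ++ zs ↭ ys ++ xs ++ zs
++-swapˡ = solve 3 (λ X Y Z → X ⊕ (Y ⊕ Z) ⊜ Y ⊕ (X ⊕ Z)) ↭-refl

IsMinimum : ℕ → List ℕ → Set
IsMinimum m xs = m ∈ xs × All (m ≤_) xs

IsMinimum-resp-↭ : ∀ {m xs ys} → xs ↭ ys → IsMinimum m xs → IsMinimum m ys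
IsMinimum-resp-↭ xs↭ys (m∈ , m≤) = ∈-resp-↭ xs↭ys m∈ , All-resp-↭ xs↭ys m≤

IsMinimum-< : ∀ {m y xs} → IsMinimum m xs → y ∈ xs → m ≢ y → m < y
IsMinimum-< (_ , m≤) y∈ m≢y = ≤∧≢⇒< (All.lookup m≤ y∈) m≢y

minimum : List ℕ → ℕ
minimum [] = 0
minimum (x ∷ xs) = Extrema.min x xs

IsMinimum-minimum : ∀ {xs} → xs ≢ [] → IsMinimum (minimum xs) xs
IsMinimum-minimum {[]} []≢[] = ⊥-elim ([]≢[] refl)
IsMinimum-minimum {x ∷ xs} _ = min∈ , Extrema.min≤⊤ x xs ∷ Extrema.min≤xs x xs
  where
  min∈ : Extrema.min x xs ∈ x ∷ xs
  min∈ with Extrema.argmin-sel id x xs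
  ... | inj₁ min≡x = here min≡x
  ... | inj₂ min∈xs = there min∈xs

minimum-unique : ∀ {m xs} → IsMinimum m xs → minimum xs ≡ m
minimum-unique {m} {x ∷ xs} (m∈ , m≤) with IsMinimum-minimum {x ∷ xs} (λ ())
... | min∈ , min≤ = ≤-antisym (All.lookup min≤ m∈) (All.lookup m≤ min∈)

Tree : Set
Tree = BTree Word

internalNodes : {A : Set} → BTree A → ℕ
internalNodes (leaf _) = 0
internalNodes (node _ l r) = suc (internalNodes l ℕ.+ internalNodes r)

DifferByOne : ℕ → ℕ → Set
DifferByOne a b = a ≡ suc b ⊎ suc a ≡ b

DifferByOne-irrefl : ∀ {a} → ¬ DifferByOne a a
DifferByOne-irrefl (inj₁ a≡1+a) = 1+n≢n (sym a≡1+a)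
DifferByOne-irrefl (inj₂ 1+a≡a) = 1+n≢n 1+a≡a

DifferByOne-left : ∀ {a b} c → DifferByOne a b → DifferByOne (suc (a ℕ.+ c)) (suc (b ℕ.+ c))
DifferByOne-left c (inj₁ a≡1+b) = inj₁ (cong (λ n → suc (n ℕ.+ c)) a≡1+b)
DifferByOne-left c (inj₂ 1+a≡b) = inj₂ (cong (λ n → suc (n ℕ.+ c)) 1+a≡b)

DifferByOne-right : ∀ {a b} c → DifferByOne a b → DifferByOne (suc (c ℕ.+ a)) (suc (c ℕ.+ b))
DifferByOne-right {a} {b} c d = subst₂ DifferByOne (cong suc (+-comm a c)) (cong suc (+-comm b c)) (DifferByOne-left c d)

h≡internalNodes : ∀ {A : Set} (t : BTree A) → h t ≡ internalNodes t
h≡internalNodes t = trans (cong (ℕ._/ 2) (edges≡ t)) (m*n/n≡m (internalNodes t) 2)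
  where
  edges≡ : ∀ {A : Set} (t : BTree A) → edges t ≡ internalNodes t ℕ.* 2
  edges≡ (leaf _) = refl
  edges≡ (node _ l r) = cong (suc ∘ suc)
    (trans (cong₂ ℕ._+_ (edges≡ l) (edges≡ r)) (sym (*-distribʳ-+ 2 (internalNodes l) (internalNodes r))))

relabelRoot : {A : Set} → A → BTree A → BTree A
relabelRoot a (leaf _) = leaf a
relabelRoot a (node _ l r) = node a l r

module _ {A : Set} {a : A} where

  rootLabel-relabelRoot : ∀ t → rootLabel (relabelRoot a t) ≡ a
  rootLabel-relabelRoot (leaf _) = refl
  rootLabel-relabelRoot (node _ _ _) = refl

  relabelRoot-idem : ∀ {b} t → relabelRoot a (relabelRoot b t) ≡ relabelRoot a t
  relabelRoot-idem (leaf _) = refl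
  relabelRoot-idem (node _ _ _) = refl

  internalNodes-relabelRoot : ∀ t → internalNodes (relabelRoot a t) ≡ internalNodes t
  internalNodes-relabelRoot (leaf _) = refl
  internalNodes-relabelRoot (node _ _ _) = refl

  AllNodes-relabelRoot : ∀ {P : A → Set} t → P a → AllNodes P t → AllNodes P (relabelRoot a t)
  AllNodes-relabelRoot (leaf _) pa _ = pa
  AllNodes-relabelRoot (node _ _ _) pa (_ , pl , pr) = pa , pl , pr

relabelRoot-rootLabel : {A : Set} (t : BTree A) → relabelRoot (rootLabel t) t ≡ t
relabelRoot-rootLabel (leaf _) = refl
relabelRoot-rootLabel (node _ _ _) = refl

AllNodes-rootLabel : {A : Set} {P : A → Set} (t : BTree A) → AllNodes P t → P (rootLabel t)
AllNodes-rootLabel (leaf _) p = p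
AllNodes-rootLabel (node _ _ _) (p , _) = p

lettersBelowRoot : Tree → Word
lettersBelowRoot (leaf _) = []
lettersBelowRoot (node _ l r) = letters l ++ letters r

letters-relabelRoot : ∀ w t → letters (relabelRoot w t) ≡ w ++ lettersBelowRoot t
letters-relabelRoot w (leaf _) = sym (++-identityʳ w)
letters-relabelRoot w (node _ l r) = refl

letters-rootLabel : ∀ t → letters t ≡ rootLabel t ++ lettersBelowRoot t
letters-rootLabel t = trans (cong letters (sym (relabelRoot-rootLabel t))) (letters-relabelRoot (rootLabel t) t)

letters-rooted : ∀ {m} t → rootLabel t ≡ [ m ] → letters t ≡ [ m ] ++ lettersBelowRoot t
letters-rooted t root≡ = trans (letters-rootLabel t) (cong (_++ lettersBelowRoot t) root≡)

relabelRoot-rooted : ∀ {m : ℕ} (s : Tree) → rootLabel s ≡ [ m ] → relabelRoot [ m ] s ≡ s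
relabelRoot-rooted s root≡ = trans (cong (λ w → relabelRoot w s) (sym root≡)) (relabelRoot-rootLabel s)

node-cong : ∀ {w w′ : Word} {l l′ r r′ : Tree} → w ≡ w′ → l ≡ l′ → r ≡ r′ → node w l r ≡ node w′ l′ r′
node-cong refl refl refl = refl

Unique-rootLabel : ∀ t → Unique (letters t) → Unique (rootLabel t)
Unique-rootLabel t u = Unique-++⁻ˡ (rootLabel t) (subst Unique (letters-rootLabel t) u)

Unique-left : ∀ w l r → Unique (letters (node w l r)) → Unique (letters l)
Unique-left w l r u = Unique-++⁻ˡ (letters l) (Unique-++⁻ʳ w u)

Unique-right : ∀ w l r → Unique (letters (node w l r)) → Unique (letters r)
Unique-right w l r u = Unique-++⁻ʳ (letters l) (Unique-++⁻ʳ w u)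

letters≢[] : ∀ t → AllNodes IsOddUnimodal t → letters t ≢ []
letters≢[] (leaf w) (u , _) = IsUnimodal⇒≢[] u
letters≢[] (node w l r) ((u , _) , _) = IsUnimodal⇒≢[] u ∘ ++-conicalˡ w _

IsMinimum-left : ∀ {m} w l r → m ∈ letters l → IsMinimum m (letters (node w l r)) → IsMinimum m (letters l)
IsMinimum-left w l r m∈l (_ , m≤) = m∈l , AllP.++⁻ˡ (letters l) (AllP.++⁻ʳ w m≤)

IsMinimum-right : ∀ {m} w l r → m ∈ letters r → IsMinimum m (letters (node w l r)) → IsMinimum m (letters r)
IsMinimum-right w l r m∈r (_ , m≤) = m∈r , AllP.++⁻ʳ (letters l) (AllP.++⁻ʳ w m≤)

∈-right : ∀ {m} w l r → m ∈ letters (node w l r) → m ∉ w → m ∉ letters l → m ∈ letters r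
∈-right w l r m∈ m∉w m∉l with ∈-++⁻ w m∈
... | inj₁ m∈w = ⊥-elim (m∉w m∈w)
... | inj₂ m∈lr with ∈-++⁻ (letters l) m∈lr
...   | inj₁ m∈l = ⊥-elim (m∉l m∈l)
...   | inj₂ m∈r = m∈r

AllNodes-OddUnimodal⇒ : ∀ t → AllNodes OddUnimodal t → AllNodes IsOddUnimodal t
AllNodes-OddUnimodal⇒ (leaf w) (_ , uni , odd) = Unimodal⇒IsUnimodal w uni , subst Odd (sym (proj₂ odd)) (Odd-suc-2* (proj₁ odd))
AllNodes-OddUnimodal⇒ (node w l r) ((_ , uni , odd) , al , ar) =
  (Unimodal⇒IsUnimodal w uni , subst Odd (sym (proj₂ odd)) (Odd-suc-2* (proj₁ odd))) , AllNodes-OddUnimodal⇒ l al , AllNodes-OddUnimodal⇒ r ar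

AllNodes-OddUnimodal⇐ : ∀ t → AllNodes IsOddUnimodal t → Unique (letters t) → AllNodes OddUnimodal t
AllNodes-OddUnimodal⇐ (leaf w) (u , odd) uniq = uniq , IsUnimodal⇒Unimodal u , Odd⇒suc-2* odd
AllNodes-OddUnimodal⇐ (node w l r) ((u , odd) , al , ar) uniq =
  (Unique-++⁻ˡ w uniq , IsUnimodal⇒Unimodal u , Odd⇒suc-2* odd) ,
  AllNodes-OddUnimodal⇐ l al (Unique-left w l r uniq) , AllNodes-OddUnimodal⇐ r ar (Unique-right w l r uniq)

mirror : Tree → Tree
mirror (leaf w) = leaf (reverse w)
mirror (node w l r) = node (reverse w) (mirror r) (mirror l)

mirror-involutive : ∀ t → mirror (mirror t) ≡ t
mirror-involutive (leaf w) = cong leaf (reverse-involutive w)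
mirror-involutive (node w l r) rewrite reverse-involutive w | mirror-involutive l | mirror-involutive r = refl

internalNodes-mirror : ∀ t → internalNodes (mirror t) ≡ internalNodes t
internalNodes-mirror (leaf w) = refl
internalNodes-mirror (node w l r) rewrite internalNodes-mirror l | internalNodes-mirror r =
  cong suc (+-comm (internalNodes r) (internalNodes l))

letters-mirror : ∀ t → letters (mirror t) ↭ letters t
letters-mirror (leaf w) = ↭-reverse w
letters-mirror (node w l r) =
  ↭-trans (++⁺ (↭-reverse w) (++⁺ (letters-mirror r) (letters-mirror l)))
    (solve 3 (λ W R L → W ⊕ (R ⊕ L) ⊜ W ⊕ (L ⊕ R)) ↭-refl w (letters r) (letters l))

rootLabel-mirror : ∀ t → rootLabel (mirror t) ≡ reverse (rootLabel t)
rootLabel-mirror (leaf w) = refl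
rootLabel-mirror (node w l r) = refl

mirror≡leaf : ∀ {t z} → mirror t ≡ leaf [ z ] → t ≡ leaf [ z ]
mirror≡leaf {t} eq = trans (sym (mirror-involutive t)) (cong mirror eq)

-- Increasing trees

RootAbove : ℕ → Tree → Set
RootAbove p t = Σ ℕ λ y → rootLabel t ≡ [ y ] × p < y

rootAbove? : ∀ p t → Dec (RootAbove p t)
rootAbove? p t = go (rootLabel t)
  where
  go : ∀ w → Dec (Σ ℕ λ y → w ≡ [ y ] × p < y)
  go [] = no λ { (_ , () , _) }
  go (y ∷ _ ∷ _) = no λ { (_ , () , _) }
  go (y ∷ []) with p <? y
  ... | yes p<y = yes (y , refl , p<y)
  ... | no p≮y = no λ { (_ , refl , p<y) → p≮y p<y }

increasing? : ∀ t → Dec (Increasing t)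
increasing? (leaf []) = no λ ()
increasing? (leaf (x ∷ [])) = yes tt
increasing? (leaf (_ ∷ _ ∷ _)) = no λ ()
increasing? (node [] l r) = no λ ()
increasing? (node (_ ∷ _ ∷ _) l r) = no λ ()
increasing? (node (x ∷ []) l r) = rootAbove? x l ×-dec rootAbove? x r ×-dec increasing? l ×-dec increasing? r

Increasing⇒AllNodes : ∀ t → Increasing t → AllNodes IsOddUnimodal t
Increasing⇒AllNodes (leaf (x ∷ [])) _ = singleton-IsOddUnimodal x
Increasing⇒AllNodes (node (x ∷ []) l r) (_ , _ , il , ir) =
  singleton-IsOddUnimodal x , Increasing⇒AllNodes l il , Increasing⇒AllNodes r ir

Increasing-letters> : ∀ {p} t → Increasing t → RootAbove p t → All (p <_) (letters t)
Increasing-letters> (leaf (x ∷ [])) _ (_ , refl , p<x) = p<x ∷ []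
Increasing-letters> (node (x ∷ []) l r) ((y , l≡y , x<y) , (z , r≡z , x<z) , il , ir) (_ , refl , p<x) =
  p<x ∷ AllP.++⁺ (Increasing-letters> l il (y , l≡y , <-trans p<x x<y))
                 (Increasing-letters> r ir (z , r≡z , <-trans p<x x<z))

Increasing-children> : ∀ x l r → Increasing (node [ x ] l r) → All (x <_) (letters l) × All (x <_) (letters r)
Increasing-children> x l r (l-above , r-above , il , ir) =
  Increasing-letters> l il l-above , Increasing-letters> r ir r-above

letters>⇒RootAbove : ∀ {p} t → Increasing t → All (p <_) (letters t) → RootAbove p t
letters>⇒RootAbove (leaf (x ∷ [])) _ (p<x ∷ _) = x , refl , p<x
letters>⇒RootAbove (node (x ∷ []) _ _) _ (p<x ∷ _) = x , refl , p<x

Increasing-node : ∀ m l r → Unique (letters (node [ m ] l r)) → All (m ≤_) (letters (node [ m ] l r)) →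
  Increasing l → Increasing r → Increasing (node [ m ] l r)
Increasing-node m l r u m≤ il ir =
  letters>⇒RootAbove l il (All.tabulate λ y∈ → above (∈-++⁺ˡ y∈)) ,
  letters>⇒RootAbove r ir (All.tabulate λ y∈ → above (∈-++⁺ʳ (letters l) y∈)) , il , ir
  where
  above : ∀ {y} → y ∈ letters l ++ letters r → m < y
  above y∈ = ≤∧≢⇒< (All.lookup m≤ (there y∈)) (Unique-++⇒≢ [ m ] u (here refl) y∈)

Increasing-rootMinimum : ∀ t → Increasing t → Σ ℕ λ x → rootLabel t ≡ [ x ] × IsMinimum x (letters t)
Increasing-rootMinimum (leaf (x ∷ [])) _ = x , refl , here refl , ≤-refl ∷ []
Increasing-rootMinimum (node (x ∷ []) l r) it with Increasing-children> x l r it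
... | x<l , x<r = x , refl , here refl , ≤-refl ∷ All.map <⇒≤ (AllP.++⁺ x<l x<r)

Increasing-mirror : ∀ t → Increasing t → Increasing (mirror t)
Increasing-mirror (leaf (x ∷ [])) _ = tt
Increasing-mirror (node (x ∷ []) l r) ((y , l≡y , x<y) , (z , r≡z , x<z) , il , ir) =
  (z , trans (rootLabel-mirror r) (cong reverse r≡z) , x<z) ,
  (y , trans (rootLabel-mirror l) (cong reverse l≡y) , x<y) ,
  Increasing-mirror r ir , Increasing-mirror l il

-- The leftmost path of an increasing tree

leftmostLeaf : Tree → ℕ
leftmostLeaf (leaf w) = first w
leftmostLeaf (node _ l _) = leftmostLeaf l

-- `leftmostParent w l` and `removeLeftmost w l r` are about the tree `node w l r`, taken apart so as to
-- recurse structurally on `l`.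
leftmostParent : Word → Tree → ℕ
leftmostParent w (leaf _) = first w
leftmostParent _ (node w′ l′ _) = leftmostParent w′ l′

removeLeftmost : Word → Tree → Tree → Tree
removeLeftmost _ (leaf _) r = r
removeLeftmost w (node w′ l′ r′) r = node w (removeLeftmost w′ l′ r′) r

insertLeftmost : ℕ → ℕ → Tree → Tree
insertLeftmost a b (leaf u) = node [ b ] (leaf [ a ]) (leaf u)
insertLeftmost a b (node w l r) with b <? first w
... | yes _ = node [ b ] (leaf [ a ]) (node w l r)
... | no _ = node w (insertLeftmost a b l) r

leftmostLeaf-∈ : ∀ t → Increasing t → leftmostLeaf t ∈ letters t
leftmostLeaf-∈ (leaf (x ∷ [])) _ = here refl
leftmostLeaf-∈ (node (x ∷ []) l r) (_ , _ , il , _) = there (∈-++⁺ˡ (leftmostLeaf-∈ l il))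

insertLeftmost-inverse : ∀ a b t → Σ Word λ w → Σ Tree λ l → Σ Tree λ r →
  insertLeftmost a b t ≡ node w l r × leftmostLeaf l ≡ a × leftmostParent w l ≡ b × removeLeftmost w l r ≡ t
insertLeftmost-inverse a b (leaf u) = _ , _ , _ , refl , refl , refl , refl
insertLeftmost-inverse a b (node w l r) with b <? first w
... | yes _ = _ , _ , _ , refl , refl , refl , refl
... | no _ with insertLeftmost-inverse a b l
...   | w′ , l′ , r′ , eq , leaf≡a , parent≡b , removed≡l rewrite eq =
  w , node w′ l′ r′ , r , refl , leaf≡a , parent≡b , cong (λ t → node w t r) removed≡l

internalNodes-insertLeftmost : ∀ a b t → internalNodes (insertLeftmost a b t) ≡ suc (internalNodes t)
internalNodes-insertLeftmost a b (leaf u) = refl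
internalNodes-insertLeftmost a b (node w l r) with b <? first w
... | yes _ = refl
... | no _ = cong (λ n → suc (n ℕ.+ internalNodes r)) (internalNodes-insertLeftmost a b l)

letters-insertLeftmost : ∀ a b t → letters (insertLeftmost a b t) ↭ b ∷ a ∷ letters t
letters-insertLeftmost a b (leaf u) = ↭-refl
letters-insertLeftmost a b (node w l r) with b <? first w
... | yes _ = ↭-refl
... | no _ =
  ↭-trans (++⁺ˡ w (++⁺ʳ (letters r) (letters-insertLeftmost a b l)))
    (solve 5 (λ W B A L R → W ⊕ ((B ⊕ (A ⊕ L)) ⊕ R) ⊜ B ⊕ (A ⊕ (W ⊕ (L ⊕ R)))) ↭-refl w [ b ] [ a ] (letters l) (letters r))

RootAbove-insertLeftmost : ∀ {p} a b t → p < b → RootAbove p t → RootAbove p (insertLeftmost a b t)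
RootAbove-insertLeftmost a b (leaf _) p<b _ = b , refl , p<b
RootAbove-insertLeftmost a b (node w l r) p<b above with b <? first w
... | yes _ = b , refl , p<b
... | no _ = above

Increasing-insertLeftmost : ∀ a b t → Increasing t → b < leftmostLeaf t → b < a → b ∉ letters t →
  Increasing (insertLeftmost a b t)
Increasing-insertLeftmost a b (leaf (x ∷ [])) _ b<x b<a _ = (a , refl , b<a) , (x , refl , b<x) , tt , tt
Increasing-insertLeftmost a b (node (p ∷ []) l r) it@(l-above , r-above , il , ir) b<leaf b<a b∉ with b <? p
... | yes b<p = (a , refl , b<a) , (p , refl , b<p) , tt , it
... | no b≮p =
  RootAbove-insertLeftmost a b l p<b l-above , r-above ,
  Increasing-insertLeftmost a b l il b<leaf b<a (b∉ ∘ there ∘ ∈-++⁺ˡ) , ir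
  where
  p<b : p < b
  p<b = ≤∧≢⇒< (≮⇒≥ b≮p) λ p≡b → b∉ (here (sym p≡b))

internalNodes-removeLeftmost : ∀ w l r → internalNodes (node w l r) ≡ suc (internalNodes (removeLeftmost w l r))
internalNodes-removeLeftmost w (leaf _) r = refl
internalNodes-removeLeftmost w (node w′ l′ r′) r =
  cong (λ n → suc (n ℕ.+ internalNodes r)) (internalNodes-removeLeftmost w′ l′ r′)

letters-removeLeftmost : ∀ p l r → Increasing (node [ p ] l r) →
  letters (node [ p ] l r) ↭ leftmostLeaf l ∷ leftmostParent [ p ] l ∷ letters (removeLeftmost [ p ] l r)
letters-removeLeftmost p (leaf (s ∷ [])) r _ = ↭-swap p s ↭-refl
letters-removeLeftmost p (node (q ∷ []) l′ r′) r (_ , _ , il , _) =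
  ↭-trans (↭-prep p (++⁺ʳ (letters r) (letters-removeLeftmost q l′ r′ il)))
    (solve 5 (λ P S₁ S₂ M R → P ⊕ ((S₁ ⊕ (S₂ ⊕ M)) ⊕ R) ⊜ S₁ ⊕ (S₂ ⊕ (P ⊕ (M ⊕ R)))) ↭-refl
      [ p ] [ leftmostLeaf l′ ] [ leftmostParent [ q ] l′ ] (letters (removeLeftmost [ q ] l′ r′)) (letters r))

leftmostParent-∈ : ∀ p l r → Increasing (node [ p ] l r) → leftmostParent [ p ] l ∈ letters (node [ p ] l r)
leftmostParent-∈ p l r it = ∈-resp-↭ (↭-sym (letters-removeLeftmost p l r it)) (there (here refl))

Increasing-removeLeftmost : ∀ p l r → Increasing (node [ p ] l r) → Increasing (removeLeftmost [ p ] l r)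
Increasing-removeLeftmost p (leaf (s ∷ [])) r (_ , _ , _ , ir) = ir
Increasing-removeLeftmost p (node (q ∷ []) l′ r′) r it@(_ , r-above , il , ir) =
  letters>⇒RootAbove l″ il″ p<l″ , r-above , il″ , ir
  where
  l″ = removeLeftmost [ q ] l′ r′
  il″ = Increasing-removeLeftmost q l′ r′ il
  p<l″ : All (p <_) (letters l″)
  p<l″ with All-resp-↭ (letters-removeLeftmost q l′ r′ il) (proj₁ (Increasing-children> p _ r it))
  ... | _ ∷ _ ∷ p<rest = p<rest

leftmostParent<leftmostLeaf : ∀ p l r → Increasing (node [ p ] l r) → leftmostParent [ p ] l < leftmostLeaf l
leftmostParent<leftmostLeaf p (leaf (s ∷ [])) r ((_ , refl , p<s) , _) = p<s
leftmostParent<leftmostLeaf p (node (q ∷ []) l′ r′) r (_ , _ , il , _) = leftmostParent<leftmostLeaf q l′ r′ il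

leftmostParent<leftmostLeaf-removeLeftmost : ∀ p l r → Increasing (node [ p ] l r) →
  leftmostParent [ p ] l < leftmostLeaf (removeLeftmost [ p ] l r)
leftmostParent<leftmostLeaf-removeLeftmost p (leaf (s ∷ [])) r it@(_ , _ , _ , ir) =
  All.lookup (proj₂ (Increasing-children> p _ r it)) (leftmostLeaf-∈ r ir)
leftmostParent<leftmostLeaf-removeLeftmost p (node (q ∷ []) l′ r′) r (_ , _ , il , _) =
  leftmostParent<leftmostLeaf-removeLeftmost q l′ r′ il

insertLeftmost-removeLeftmost : ∀ p l r → Increasing (node [ p ] l r) →
  insertLeftmost (leftmostLeaf l) (leftmostParent [ p ] l) (removeLeftmost [ p ] l r) ≡ node [ p ] l r
insertLeftmost-removeLeftmost p (leaf (s ∷ [])) (leaf _) _ = refl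
insertLeftmost-removeLeftmost p (leaf (s ∷ [])) (node (y ∷ []) _ _) (_ , (_ , refl , p<y) , _) with p <? y
... | yes _ = refl
... | no p≮y = ⊥-elim (p≮y p<y)
insertLeftmost-removeLeftmost p (node (q ∷ []) l′ r′) r it@(_ , _ , il , _) with leftmostParent [ q ] l′ <? p
... | yes s₂<p = ⊥-elim (<-asym s₂<p (All.lookup (proj₁ (Increasing-children> p _ r it)) (leftmostParent-∈ q l′ r′ il)))
... | no _ = cong (λ t → node [ p ] t r) (insertLeftmost-removeLeftmost q l′ r′ il)

-- Trading two letters between a word and an increasing tree

shrinkʳ : Word → Tree → Word × Tree
shrinkʳ v t = dropLast (dropLast v) , insertLeftmost (last (dropLast v)) (last v) t

transferʳ : Word → Tree → Word × Tree
transferʳ v (leaf u) = shrinkʳ v (leaf u)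
transferʳ v (node w l r) with unimodal? (v ∷ʳ leftmostLeaf l)
... | yes _ = v ∷ʳ leftmostLeaf l ∷ʳ leftmostParent w l , removeLeftmost w l r
... | no _ = shrinkʳ v (node w l r)

shrinkʳ-∷ʳ-∷ʳ : ∀ u a b t → shrinkʳ (u ∷ʳ a ∷ʳ b) t ≡ (u , insertLeftmost a b t)
shrinkʳ-∷ʳ-∷ʳ u a b t rewrite dropLast-∷ʳ (u ∷ʳ a) b | dropLast-∷ʳ u a | last-∷ʳ u a | last-∷ʳ (u ∷ʳ a) b = refl

transferʳ-shrink : ∀ v t → ¬ IsUnimodal (v ∷ʳ leftmostLeaf t) → transferʳ v t ≡ shrinkʳ v t
transferʳ-shrink v (leaf u) _ = refl
transferʳ-shrink v (node w l r) ¬u with unimodal? (v ∷ʳ leftmostLeaf l)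
... | yes u = ⊥-elim (¬u u)
... | no _ = refl

transferʳ-insertLeftmost : ∀ v a b t → IsUnimodal (v ∷ʳ a) → transferʳ v (insertLeftmost a b t) ≡ (v ∷ʳ a ∷ʳ b , t)
transferʳ-insertLeftmost v a b t u with insertLeftmost-inverse a b t
... | w , l , r , eq , refl , refl , removed≡t rewrite eq with unimodal? (v ∷ʳ leftmostLeaf l)
...   | yes _ = cong (_ ,_) removed≡t
...   | no ¬u = ⊥-elim (¬u u)

data Extendsʳ (v : Word) : Tree → Set where
  extendsʳ : ∀ {z} → IsUnimodal (v ∷ʳ z) → Extendsʳ v (leaf [ z ])

extendsʳ? : ∀ v t → Dec (Extendsʳ v t)
extendsʳ? v (leaf (z ∷ [])) = Dec.map′ extendsʳ (λ { (extendsʳ u) → u }) (unimodal? (v ∷ʳ z))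
extendsʳ? v (leaf []) = no λ ()
extendsʳ? v (leaf (_ ∷ _ ∷ _)) = no λ ()
extendsʳ? v (node _ _ _) = no λ ()

Extendsʳ⇒IsUnimodal : ∀ {v t} → Extendsʳ v t → IsUnimodal (v ∷ʳ leftmostLeaf t)
Extendsʳ⇒IsUnimodal (extendsʳ u) = u

record IsTransfer (transfer : Word → Tree → Word × Tree) (Extends : Word → Tree → Set)
                  (v : Word) (t : Tree) (v′ : Word) (t′ : Tree) : Set where
  field
    oddUnimodal : IsOddUnimodal v′
    increasing : Increasing t′
    letters↭ : v′ ++ letters t′ ↭ v ++ letters t
    ¬extends : ¬ Extends v′ t′
    inverse : transfer v′ t′ ≡ (v , t)
    differByOne : DifferByOne (internalNodes t′) (internalNodes t)

transferʳ-grows : ∀ v p l r → IsOddUnimodal v → Increasing (node [ p ] l r) → IsUnimodal (v ∷ʳ leftmostLeaf l) →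
  IsTransfer transferʳ Extendsʳ v (node [ p ] l r) (v ∷ʳ leftmostLeaf l ∷ʳ leftmostParent [ p ] l) (removeLeftmost [ p ] l r)
transferʳ-grows v p l r (_ , odd) it u = record
  { oddUnimodal = IsUnimodal-∷ʳ-fall u (subst (s₂ <_) (sym (last-∷ʳ v s₁)) s₂<s₁)
                , subst Odd (sym (length-∷ʳ-∷ʳ v s₁ s₂)) (plus-two odd)
  ; increasing = Increasing-removeLeftmost p l r it
  ; letters↭ = subst (_↭ v ++ letters (node [ p ] l r)) (sym (++-∷ʳ-∷ʳ v s₁ s₂ (letters t′)))
                 (++⁺ˡ v (↭-sym (letters-removeLeftmost p l r it)))
  ; ¬extends = ¬grows ∘ Extendsʳ⇒IsUnimodal
  ; inverse = begin
      transferʳ v′ t′                ≡⟨ transferʳ-shrink v′ t′ ¬grows ⟩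
      shrinkʳ v′ t′                  ≡⟨ shrinkʳ-∷ʳ-∷ʳ v s₁ s₂ t′ ⟩
      v , insertLeftmost s₁ s₂ t′    ≡⟨ cong (v ,_) (insertLeftmost-removeLeftmost p l r it) ⟩
      v , node [ p ] l r             ∎
  ; differByOne = inj₂ (sym (internalNodes-removeLeftmost [ p ] l r)) }
  where
  open ≡-Reasoning
  s₁ = leftmostLeaf l
  s₂ = leftmostParent [ p ] l
  v′ = v ∷ʳ s₁ ∷ʳ s₂
  t′ = removeLeftmost [ p ] l r
  s₂<s₁ = leftmostParent<leftmostLeaf p l r it
  ¬grows : ¬ IsUnimodal (v′ ∷ʳ leftmostLeaf t′)
  ¬grows = no-valley v s₂<s₁ (leftmostParent<leftmostLeaf-removeLeftmost p l r it)

transferʳ-shrinks : ∀ u a b t → IsOddUnimodal (u ∷ʳ a ∷ʳ b) → Increasing t →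
  Unique ((u ∷ʳ a ∷ʳ b) ++ letters t) → ¬ IsUnimodal (u ∷ʳ a ∷ʳ b ∷ʳ leftmostLeaf t) →
  IsTransfer transferʳ Extendsʳ (u ∷ʳ a ∷ʳ b) t u (insertLeftmost a b t)
transferʳ-shrinks u a b t (uv , odd) it uniq ¬grows = record
  { oddUnimodal = IsUnimodal-init u (Odd⇒≢[] odd-u) uua , odd-u
  ; increasing = Increasing-insertLeftmost a b t it b<s b<a (Unique-++⇒∉ v uniq b∈v)
  ; letters↭ = ↭-trans (++⁺ˡ u (letters-insertLeftmost a b t))
      (subst (u ++ b ∷ a ∷ letters t ↭_) (sym (++-∷ʳ-∷ʳ u a b (letters t))) (++⁺ˡ u (↭-swap b a ↭-refl)))
  ; ¬extends = λ ext → ¬Extendsʳ-node (subst (Extendsʳ u) eq ext)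
  ; inverse = transferʳ-insertLeftmost u a b t uua
  ; differByOne = inj₁ (internalNodes-insertLeftmost a b t) }
  where
  v = u ∷ʳ a ∷ʳ b
  odd-u : Odd (length u)
  odd-u = Odd-pred (subst Odd (length-∷ʳ-∷ʳ u a b) odd)
  uua : IsUnimodal (u ∷ʳ a)
  uua = IsUnimodal-init (u ∷ʳ a) (∷ʳ-≢-[] u a) uv
  b∈v : b ∈ v
  b∈v = ∈-++⁺ʳ (u ∷ʳ a) (here refl)
  a≢b : a ≢ b
  a≢b = Unique-++⇒≢ (u ∷ʳ a) (Unique-++⁻ˡ v uniq) (∈-++⁺ʳ u (here refl)) (here refl)
  b<a×b<s = ¬IsUnimodal-∷ʳ⇒valley u a b uv a≢b (Unique-++⇒≢ v uniq b∈v (leftmostLeaf-∈ t it)) ¬grows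
  b<a = proj₁ b<a×b<s
  b<s = proj₂ b<a×b<s
  eq = proj₁ (proj₂ (proj₂ (proj₂ (insertLeftmost-inverse a b t))))
  ¬Extendsʳ-node : ∀ {w l r} → ¬ Extendsʳ u (node w l r)
  ¬Extendsʳ-node ()

shrinkʳ-correct : ∀ v t → IsOddUnimodal v → Increasing t → Unique (v ++ letters t) →
  ¬ IsUnimodal (v ∷ʳ leftmostLeaf t) → IsTransfer transferʳ Extendsʳ v t (proj₁ (shrinkʳ v t)) (proj₂ (shrinkʳ v t))
shrinkʳ-correct v t ov it uniq ¬grows with initLast v
... | [] = ⊥-elim (Odd⇒≢[] (proj₂ ov) refl)
... | xs ∷ʳ′ b with initLast xs
...   | [] = ⊥-elim (¬grows (pair-IsUnimodal (Unique-++⇒≢ [ b ] uniq (here refl) (leftmostLeaf-∈ t it))))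
...   | u ∷ʳ′ a = subst (λ (v′ , t′) → IsTransfer transferʳ Extendsʳ (u ∷ʳ a ∷ʳ b) t v′ t′)
                  (sym (shrinkʳ-∷ʳ-∷ʳ u a b t)) (transferʳ-shrinks u a b t ov it uniq ¬grows)

transferʳ-correct : ∀ v t → IsOddUnimodal v → Increasing t → Unique (v ++ letters t) → ¬ Extendsʳ v t →
  IsTransfer transferʳ Extendsʳ v t (proj₁ (transferʳ v t)) (proj₂ (transferʳ v t))
transferʳ-correct v (leaf (z ∷ [])) ov it uniq ¬ext = shrinkʳ-correct v (leaf [ z ]) ov it uniq (¬ext ∘ extendsʳ)
transferʳ-correct v (node (p ∷ []) l r) ov it uniq _ with unimodal? (v ∷ʳ leftmostLeaf l)
... | yes u = transferʳ-grows v p l r ov it u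
... | no ¬u = shrinkʳ-correct v (node [ p ] l r) ov it uniq ¬u

transferˡ : Word → Tree → Word × Tree
transferˡ v t = Product.map reverse mirror (transferʳ (reverse v) (mirror t))

data Extendsˡ (v : Word) : Tree → Set where
  extendsˡ : ∀ {x} → IsUnimodal (x ∷ v) → Extendsˡ v (leaf [ x ])

extendsˡ? : ∀ v t → Dec (Extendsˡ v t)
extendsˡ? v (leaf (x ∷ [])) = Dec.map′ extendsˡ (λ { (extendsˡ u) → u }) (unimodal? (x ∷ v))
extendsˡ? v (leaf []) = no λ ()
extendsˡ? v (leaf (_ ∷ _ ∷ _)) = no λ ()
extendsˡ? v (node _ _ _) = no λ ()

Extendsʳ-mirror : ∀ v t → Extendsʳ (reverse v) (mirror t) → Extendsˡ v t
Extendsʳ-mirror v t ext with mirror t in eq | ext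
... | leaf (z ∷ []) | extendsʳ u = subst (Extendsˡ v) (sym (mirror≡leaf eq))
  (extendsˡ (IsUnimodal-reverse⁻ (subst IsUnimodal (sym (unfold-reverse z v)) u)))

Extendsˡ-mirror : ∀ v t → Extendsˡ (reverse v) (mirror t) → Extendsʳ v t
Extendsˡ-mirror v t ext with mirror t in eq | ext
... | leaf (x ∷ []) | extendsˡ u = subst (Extendsʳ v) (sym (mirror≡leaf eq))
  (extendsʳ (IsUnimodal-reverse⁻ (subst IsUnimodal (sym (reverse-++ v [ x ])) u)))

transferˡ-correct : ∀ v t → IsOddUnimodal v → Increasing t → Unique (v ++ letters t) → ¬ Extendsˡ v t →
  IsTransfer transferˡ Extendsˡ v t (proj₁ (transferˡ v t)) (proj₂ (transferˡ v t))
transferˡ-correct v t ov it uniq ¬ext = record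
  { oddUnimodal = IsOddUnimodal-reverse M.oddUnimodal
  ; increasing = Increasing-mirror t′ M.increasing
  ; letters↭ = ↭-trans (++⁺ (↭-reverse v′) (letters-mirror t′)) (↭-trans M.letters↭ mirrored↭)
  ; ¬extends = M.¬extends ∘ Extendsˡ-mirror v′ t′
  ; inverse = inverse
  ; differByOne = subst₂ DifferByOne (sym (internalNodes-mirror t′)) (internalNodes-mirror t) M.differByOne }
  where
  mirrored↭ : reverse v ++ letters (mirror t) ↭ v ++ letters t
  mirrored↭ = ++⁺ (↭-reverse v) (letters-mirror t)
  module M = IsTransfer (transferʳ-correct (reverse v) (mirror t) (IsOddUnimodal-reverse ov) (Increasing-mirror t it)
    (Unique-resp-↭ (↭-sym mirrored↭) uniq) (¬ext ∘ Extendsʳ-mirror v t))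
  v′ = proj₁ (transferʳ (reverse v) (mirror t))
  t′ = proj₂ (transferʳ (reverse v) (mirror t))
  inverse : transferˡ (reverse v′) (mirror t′) ≡ (v , t)
  inverse rewrite reverse-involutive v′ | mirror-involutive t′ | M.inverse | reverse-involutive v | mirror-involutive t = refl

-- The involution

_≟ʷ_ : (v w : Word) → Dec (v ≡ w)
_≟ʷ_ = ≡-dec _≟_

splitˡ : ℕ → Tree → Tree
splitˡ m t = node (interior (rootLabel t)) (relabelRoot [ m ] t) (leaf [ last (rootLabel t) ])

splitʳ : ℕ → Tree → Tree
splitʳ m t = node (interior (rootLabel t)) (leaf [ first (rootLabel t) ]) (relabelRoot [ m ] t)

mutual
  κ : Tree → Tree
  κ t = κ-at (minimum (letters t)) t

  κ-at : ℕ → Tree → Tree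
  κ-at m t with rootLabel t ≟ʷ [ m ]
  ... | yes _ = κ-rooted t
  ... | no _ = φ m t

  κ-rooted : Tree → Tree
  κ-rooted (leaf w) = leaf w
  κ-rooted (node w l r) with increasing? l | increasing? r
  ... | no _ | _ = node w (κ l) r
  ... | yes _ | no _ = node w l (κ r)
  ... | yes _ | yes _ = node w l r

  φ : ℕ → Tree → Tree
  φ m t with first (rootLabel t) ≟ m | last (rootLabel t) ≟ m
  ... | yes _ | _ = splitˡ m t
  ... | no _ | yes _ = splitʳ m t
  ... | no _ | no _ = φ-below m t

  φ-below : ℕ → Tree → Tree
  -- Unreachable: a least letter inside a leaf label lies at one of its ends.
  φ-below m (leaf w) = leaf w
  φ-below m (node w l r) with m ∈? letters l
  ... | yes _ = φ-left m w l r
  ... | no _ = φ-right m w l r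

  φ-left : ℕ → Word → Tree → Tree → Tree
  φ-left m w l r with rootLabel l ≟ʷ [ m ] | extendsʳ? w r | increasing? r
  ... | no _ | _ | _ = node w (φ m l) r
  ... | yes _ | yes _ | _ = relabelRoot (m ∷ w ++ rootLabel r) l
  ... | yes _ | no _ | yes _ = node (proj₁ (transferʳ w r)) l (proj₂ (transferʳ w r))
  ... | yes _ | no _ | no _ = node w l (κ r)

  φ-right : ℕ → Word → Tree → Tree → Tree
  φ-right m w l r with rootLabel r ≟ʷ [ m ] | extendsˡ? w l | increasing? l
  ... | no _ | _ | _ = node w l (φ m r)
  ... | yes _ | yes _ | _ = relabelRoot (rootLabel l ++ w ∷ʳ m) r
  ... | yes _ | no _ | yes _ = node (proj₁ (transferˡ w l)) (proj₂ (transferˡ w l)) r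
  ... | yes _ | no _ | no _ = node w (κ l) r

κ-rooted-left : ∀ w l r → ¬ Increasing l → κ-rooted (node w l r) ≡ node w (κ l) r
κ-rooted-left w l r ¬il with increasing? l
... | yes il = ⊥-elim (¬il il)
... | no _ = refl

κ-rooted-right : ∀ w l r → Increasing l → ¬ Increasing r → κ-rooted (node w l r) ≡ node w l (κ r)
κ-rooted-right w l r il ¬ir with increasing? l | increasing? r
... | no ¬il | _ = ⊥-elim (¬il il)
... | yes _ | yes ir = ⊥-elim (¬ir ir)
... | yes _ | no _ = refl

κ-rooted-increasing : ∀ t → Increasing t → κ-rooted t ≡ t
κ-rooted-increasing (leaf _) _ = refl
κ-rooted-increasing (node (x ∷ []) l r) (_ , _ , il , ir) with increasing? l | increasing? r
... | no ¬il | _ = ⊥-elim (¬il il)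
... | yes _ | no ¬ir = ⊥-elim (¬ir ir)
... | yes _ | yes _ = refl

module _ (m : ℕ) where

  κ-at-rooted : ∀ t → rootLabel t ≡ [ m ] → κ-at m t ≡ κ-rooted t
  κ-at-rooted t root≡ with rootLabel t ≟ʷ [ m ]
  ... | yes _ = refl
  ... | no root≢ = ⊥-elim (root≢ root≡)

  κ-at-unrooted : ∀ t → rootLabel t ≢ [ m ] → κ-at m t ≡ φ m t
  κ-at-unrooted t root≢ with rootLabel t ≟ʷ [ m ]
  ... | yes root≡ = ⊥-elim (root≢ root≡)
  ... | no _ = refl

  φ-first : ∀ t → first (rootLabel t) ≡ m → φ m t ≡ splitˡ m t
  φ-first t first≡ with first (rootLabel t) ≟ m
  ... | yes _ = refl
  ... | no first≢ = ⊥-elim (first≢ first≡)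

  φ-last : ∀ t → first (rootLabel t) ≢ m → last (rootLabel t) ≡ m → φ m t ≡ splitʳ m t
  φ-last t first≢ last≡ with first (rootLabel t) ≟ m | last (rootLabel t) ≟ m
  ... | yes first≡ | _ = ⊥-elim (first≢ first≡)
  ... | no _ | yes _ = refl
  ... | no _ | no last≢ = ⊥-elim (last≢ last≡)

  φ-inner : ∀ w l r → IsUnimodal w → m ∉ w → φ m (node w l r) ≡ φ-below m (node w l r)
  φ-inner w l r u m∉w with first w ≟ m | last w ≟ m
  ... | yes first≡ | _ = ⊥-elim (m∉w (subst (_∈ w) first≡ (IsUnimodal⇒first-∈ u)))
  ... | no _ | yes last≡ = ⊥-elim (m∉w (subst (_∈ w) last≡ (IsUnimodal⇒last-∈ u)))
  ... | no _ | no _ = refl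

  φ-node-left : ∀ w l r → IsUnimodal w → m ∉ w → m ∈ letters l → φ m (node w l r) ≡ φ-left m w l r
  φ-node-left w l r u m∉w m∈l rewrite φ-inner w l r u m∉w with m ∈? letters l
  ... | yes _ = refl
  ... | no m∉l = ⊥-elim (m∉l m∈l)

  φ-node-right : ∀ w l r → IsUnimodal w → m ∉ w → m ∉ letters l → φ m (node w l r) ≡ φ-right m w l r
  φ-node-right w l r u m∉w m∉l rewrite φ-inner w l r u m∉w with m ∈? letters l
  ... | yes m∈l = ⊥-elim (m∉l m∈l)
  ... | no _ = refl

  module _ (w : Word) (l r : Tree) where

    φ-left-descend : rootLabel l ≢ [ m ] → φ-left m w l r ≡ node w (φ m l) r
    φ-left-descend root≢ with rootLabel l ≟ʷ [ m ]
    ... | yes root≡ = ⊥-elim (root≢ root≡)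
    ... | no _ = refl

    φ-left-merge : rootLabel l ≡ [ m ] → Extendsʳ w r → φ-left m w l r ≡ relabelRoot (m ∷ w ++ rootLabel r) l
    φ-left-merge root≡ ext with rootLabel l ≟ʷ [ m ] | extendsʳ? w r
    ... | no root≢ | _ = ⊥-elim (root≢ root≡)
    ... | yes _ | no ¬ext = ⊥-elim (¬ext ext)
    ... | yes _ | yes _ = refl

    φ-left-transfer : rootLabel l ≡ [ m ] → ¬ Extendsʳ w r → Increasing r →
      φ-left m w l r ≡ node (proj₁ (transferʳ w r)) l (proj₂ (transferʳ w r))
    φ-left-transfer root≡ ¬ext ir with rootLabel l ≟ʷ [ m ] | extendsʳ? w r | increasing? r
    ... | no root≢ | _ | _ = ⊥-elim (root≢ root≡)
    ... | yes _ | yes ext | _ = ⊥-elim (¬ext ext)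
    ... | yes _ | no _ | no ¬ir = ⊥-elim (¬ir ir)
    ... | yes _ | no _ | yes _ = refl

    φ-left-κ : rootLabel l ≡ [ m ] → ¬ Increasing r → φ-left m w l r ≡ node w l (κ r)
    φ-left-κ root≡ ¬ir with rootLabel l ≟ʷ [ m ] | extendsʳ? w r | increasing? r
    ... | no root≢ | _ | _ = ⊥-elim (root≢ root≡)
    ... | yes _ | yes (extendsʳ _) | _ = ⊥-elim (¬ir tt)
    ... | yes _ | no _ | yes ir = ⊥-elim (¬ir ir)
    ... | yes _ | no _ | no _ = refl

    φ-right-descend : rootLabel r ≢ [ m ] → φ-right m w l r ≡ node w l (φ m r)
    φ-right-descend root≢ with rootLabel r ≟ʷ [ m ]
    ... | yes root≡ = ⊥-elim (root≢ root≡)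
    ... | no _ = refl

    φ-right-merge : rootLabel r ≡ [ m ] → Extendsˡ w l → φ-right m w l r ≡ relabelRoot (rootLabel l ++ w ∷ʳ m) r
    φ-right-merge root≡ ext with rootLabel r ≟ʷ [ m ] | extendsˡ? w l
    ... | no root≢ | _ = ⊥-elim (root≢ root≡)
    ... | yes _ | no ¬ext = ⊥-elim (¬ext ext)
    ... | yes _ | yes _ = refl

    φ-right-transfer : rootLabel r ≡ [ m ] → ¬ Extendsˡ w l → Increasing l →
      φ-right m w l r ≡ node (proj₁ (transferˡ w l)) (proj₂ (transferˡ w l)) r
    φ-right-transfer root≡ ¬ext il with rootLabel r ≟ʷ [ m ] | extendsˡ? w l | increasing? l
    ... | no root≢ | _ | _ = ⊥-elim (root≢ root≡)
    ... | yes _ | yes ext | _ = ⊥-elim (¬ext ext)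
    ... | yes _ | no _ | no ¬il = ⊥-elim (¬il il)
    ... | yes _ | no _ | yes _ = refl

    φ-right-κ : rootLabel r ≡ [ m ] → ¬ Increasing l → φ-right m w l r ≡ node w (κ l) r
    φ-right-κ root≡ ¬il with rootLabel r ≟ʷ [ m ] | extendsˡ? w l | increasing? l
    ... | no root≢ | _ | _ = ⊥-elim (root≢ root≡)
    ... | yes _ | yes (extendsˡ _) | _ = ⊥-elim (¬il tt)
    ... | yes _ | no _ | yes il = ⊥-elim (¬il il)
    ... | yes _ | no _ | no _ = refl

splitˡ-relabelRoot : ∀ m w s → splitˡ m (relabelRoot w s) ≡ node (interior w) (relabelRoot [ m ] s) (leaf [ last w ])
splitˡ-relabelRoot m w (leaf _) = refl
splitˡ-relabelRoot m w (node _ _ _) = refl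

splitʳ-relabelRoot : ∀ m w s → splitʳ m (relabelRoot w s) ≡ node (interior w) (leaf [ first w ]) (relabelRoot [ m ] s)
splitʳ-relabelRoot m w (leaf _) = refl
splitʳ-relabelRoot m w (node _ _ _) = refl

κ≡κ-at : ∀ {m} t → IsMinimum m (letters t) → κ t ≡ κ-at m t
κ≡κ-at t min = cong (λ k → κ-at k t) (minimum-unique min)

κ-fixes-increasing : ∀ t → Increasing t → κ t ≡ t
κ-fixes-increasing t it with Increasing-rootMinimum t it
... | x , root≡ , min = trans (κ≡κ-at t min) (trans (κ-at-rooted x t root≡) (κ-rooted-increasing t it))

record IsφImage (m : ℕ) (t u : Tree) : Set where
  field
    letters↭ : letters u ↭ letters t
    oddUnimodal : AllNodes IsOddUnimodal u
    root≢ : rootLabel u ≢ [ m ]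
    inverse : φ m u ≡ t
    differByOne : DifferByOne (internalNodes u) (internalNodes t)

record κ-Correct (t : Tree) : Set where
  field
    letters↭ : letters (κ t) ↭ letters t
    oddUnimodal : AllNodes IsOddUnimodal (κ t)
    involutive : κ (κ t) ≡ t
    differByOne : ¬ Increasing t → DifferByOne (internalNodes (κ t)) (internalNodes t)

κ-Correct⇒¬Increasing : ∀ {t} → κ-Correct t → ¬ Increasing t → ¬ Increasing (κ t)
κ-Correct⇒¬Increasing {t} κt ¬it iκt =
  ¬it (subst Increasing (trans (sym (κ-fixes-increasing (κ t) iκt)) (κ-Correct.involutive κt)) iκt)

mergeˡ-correct : ∀ m w l z → AllNodes IsOddUnimodal (node w l (leaf [ z ])) →
  IsMinimum m (letters (node w l (leaf [ z ]))) → m ∉ w → rootLabel l ≡ [ m ] → IsUnimodal (w ∷ʳ z) →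
  IsφImage m (node w l (leaf [ z ])) (relabelRoot (m ∷ w ∷ʳ z) l)
mergeˡ-correct m [] l z ((() , _) , _) _ _ _ _
mergeˡ-correct m w@(c ∷ cs) l z ((_ , odd) , al , _) min m∉w root≡ wz = record
  { letters↭ = subst₂ _↭_ (sym (letters-relabelRoot W l)) (cong (λ xs → w ++ xs ++ [ z ]) (sym (letters-rooted l root≡)))
      (solve 4 (λ M V Z K → (M ⊕ (V ⊕ Z)) ⊕ K ⊜ V ⊕ ((M ⊕ K) ⊕ Z)) ↭-refl [ m ] w [ z ] (lettersBelowRoot l))
  ; oddUnimodal = AllNodes-relabelRoot l (rising m<c wz , subst Odd (cong suc (sym (length-∷ʳ w z))) (plus-two odd)) al
  ; root≢ = λ root≡[m] → ∷ʳ-≢-[] w z (∷-injectiveʳ (trans (sym (rootLabel-relabelRoot l)) root≡[m]))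
  ; inverse = begin
      φ m (relabelRoot W l)                                     ≡⟨ φ-first m _ (cong first (rootLabel-relabelRoot l)) ⟩
      splitˡ m (relabelRoot W l)                                ≡⟨ splitˡ-relabelRoot m W l ⟩
      node (interior W) (relabelRoot [ m ] l) (leaf [ last W ]) ≡⟨ node-cong (dropLast-∷ʳ w z) (relabelRoot-rooted l root≡)
                                                                     (cong (leaf ∘ [_]) (last-∷ʳ (m ∷ w) z)) ⟩
      node w l (leaf [ z ])                                     ∎
  ; differByOne = inj₂ (cong suc (trans (internalNodes-relabelRoot l) (sym (+-identityʳ _)))) }
  where
  open ≡-Reasoning
  W = m ∷ w ∷ʳ z
  m<c : m < c
  m<c = IsMinimum-< min (here refl) (m∉w ∘ here)

mergeʳ-correct : ∀ m w x r → AllNodes IsOddUnimodal (node w (leaf [ x ]) r) →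
  IsMinimum m (letters (node w (leaf [ x ]) r)) → m ∉ w → x ≢ m → rootLabel r ≡ [ m ] → IsUnimodal (x ∷ w) →
  IsφImage m (node w (leaf [ x ]) r) (relabelRoot (x ∷ w ∷ʳ m) r)
mergeʳ-correct m [] x r ((() , _) , _) _ _ _ _ _
mergeʳ-correct m w@(c ∷ cs) x r ((_ , odd) , _ , ar) min m∉w x≢m root≡ xw = record
  { letters↭ = subst₂ _↭_ (sym (letters-relabelRoot W r)) (cong (λ xs → w ++ x ∷ xs) (sym (letters-rooted r root≡)))
      (solve 4 (λ X M V K → (X ⊕ (V ⊕ M)) ⊕ K ⊜ V ⊕ (X ⊕ (M ⊕ K))) ↭-refl [ x ] [ m ] w (lettersBelowRoot r))
  ; oddUnimodal = AllNodes-relabelRoot r (IsUnimodal-∷ʳ-fall xw m<last , subst Odd (cong suc (sym (length-∷ʳ w m))) (plus-two odd)) ar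
  ; root≢ = λ root≡[m] → ∷ʳ-≢-[] w m (∷-injectiveʳ (trans (sym (rootLabel-relabelRoot r)) root≡[m]))
  ; inverse = begin
      φ m (relabelRoot W r)                                      ≡⟨ φ-last m _ (subst (λ w → first w ≢ m) (sym (rootLabel-relabelRoot r)) x≢m)
                                                                      (cong last (rootLabel-relabelRoot r) ⟨ trans ⟩ last-∷ʳ (x ∷ w) m) ⟩
      splitʳ m (relabelRoot W r)                                 ≡⟨ splitʳ-relabelRoot m W r ⟩
      node (interior W) (leaf [ x ]) (relabelRoot [ m ] r)       ≡⟨ node-cong (dropLast-∷ʳ w m) refl (relabelRoot-rooted r root≡) ⟩
      node w (leaf [ x ]) r                                      ∎
  ; differByOne = inj₂ (cong suc (internalNodes-relabelRoot r)) }
  where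
  open ≡-Reasoning
  W = x ∷ w ∷ʳ m
  m<last : m < last (x ∷ w)
  m<last = IsMinimum-< min (∈-++⁺ˡ (last-∈ c cs)) λ m≡last → m∉w (subst (_∈ w) (sym m≡last) (last-∈ c cs))

splitˡ-correct : ∀ m t → AllNodes IsOddUnimodal t → Unique (letters t) → rootLabel t ≢ [ m ] →
  first (rootLabel t) ≡ m → IsφImage m t (splitˡ m t)
splitˡ-correct m t ao uniq root≢ first≡ = record
  { letters↭ = subst₂ _↭_ (cong (λ xs → v ++ xs ++ [ z ]) (sym (letters-relabelRoot [ m ] t)))
      (sym (trans (letters-rootLabel t) (cong (_++ K) shape)))
      (solve 4 (λ M V Z K → V ⊕ ((M ⊕ K) ⊕ Z) ⊜ (M ⊕ (V ⊕ Z)) ⊕ K) ↭-refl [ m ] v [ z ] K)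
  ; oddUnimodal = S.interior-oddUnimodal , AllNodes-relabelRoot t (singleton-IsOddUnimodal m) ao , singleton-IsOddUnimodal z
  ; root≢ = λ v≡[m] → m∉v (subst (m ∈_) (sym v≡[m]) (here refl))
  ; inverse = begin
      φ m (node v X L)             ≡⟨ φ-node-left m v X L (proj₁ S.interior-oddUnimodal) m∉v
                                        (subst (m ∈_) (sym (letters-relabelRoot [ m ] t)) (here refl)) ⟩
      φ-left m v X L               ≡⟨ φ-left-merge m v X L (rootLabel-relabelRoot t) (extendsʳ S.interior∷ʳlast-unimodal) ⟩
      relabelRoot (m ∷ v ∷ʳ z) X   ≡⟨ relabelRoot-idem t ⟩
      relabelRoot (m ∷ v ∷ʳ z) t   ≡⟨ cong (λ w → relabelRoot w t) (sym shape) ⟩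
      relabelRoot (rootLabel t) t  ≡⟨ relabelRoot-rootLabel t ⟩
      t                            ∎
  ; differByOne = inj₁ (cong suc (trans (+-identityʳ _) (internalNodes-relabelRoot t))) }
  where
  open ≡-Reasoning
  w = rootLabel t
  S = outerSplit (AllNodes-rootLabel t ao) λ x w≡[x] → root≢ (subst (λ y → w ≡ [ y ]) (sym (cong first w≡[x]) ⟨ trans ⟩ first≡) w≡[x])
  module S = OuterSplit S
  v = interior w
  z = last w
  K = lettersBelowRoot t
  X = relabelRoot [ m ] t
  L = leaf [ z ]
  shape : w ≡ m ∷ v ∷ʳ z
  shape = subst (λ x → w ≡ x ∷ v ∷ʳ z) first≡ S.shape
  m∉v : m ∉ v
  m∉v m∈v = UniqueProps.Unique[x∷xs]⇒x∉xs (subst Unique shape (Unique-rootLabel t uniq)) (∈-++⁺ˡ m∈v)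

splitʳ-correct : ∀ m t → AllNodes IsOddUnimodal t → Unique (letters t) → rootLabel t ≢ [ m ] →
  first (rootLabel t) ≢ m → last (rootLabel t) ≡ m → IsφImage m t (splitʳ m t)
splitʳ-correct m t ao uniq root≢ first≢ last≡ = record
  { letters↭ = subst₂ _↭_ (cong (λ xs → v ++ x ∷ xs) (sym (letters-relabelRoot [ m ] t)))
      (sym (trans (letters-rootLabel t) (cong (_++ K) shape)))
      (solve 4 (λ X M V K → V ⊕ (X ⊕ (M ⊕ K)) ⊜ (X ⊕ (V ⊕ M)) ⊕ K) ↭-refl [ x ] [ m ] v K)
  ; oddUnimodal = S.interior-oddUnimodal , singleton-IsOddUnimodal x , AllNodes-relabelRoot t (singleton-IsOddUnimodal m) ao
  ; root≢ = λ v≡[m] → m∉v (subst (m ∈_) (sym v≡[m]) (here refl))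
  ; inverse = begin
      φ m (node v L X)             ≡⟨ φ-node-right m v L X (proj₁ S.interior-oddUnimodal) m∉v
                                        (λ { (here m≡x) → first≢ (sym m≡x) }) ⟩
      φ-right m v L X              ≡⟨ φ-right-merge m v L X (rootLabel-relabelRoot t) (extendsˡ S.first∷interior-unimodal) ⟩
      relabelRoot (x ∷ v ∷ʳ m) X   ≡⟨ relabelRoot-idem t ⟩
      relabelRoot (x ∷ v ∷ʳ m) t   ≡⟨ cong (λ w → relabelRoot w t) (sym shape) ⟩
      relabelRoot (rootLabel t) t  ≡⟨ relabelRoot-rootLabel t ⟩
      t                            ∎
  ; differByOne = inj₁ (cong suc (internalNodes-relabelRoot t)) }
  where
  open ≡-Reasoning
  w = rootLabel t
  S = outerSplit (AllNodes-rootLabel t ao) λ y w≡[y] → root≢ (subst (λ y → w ≡ [ y ]) (sym (cong last w≡[y]) ⟨ trans ⟩ last≡) w≡[y])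
  module S = OuterSplit S
  v = interior w
  x = first w
  K = lettersBelowRoot t
  X = relabelRoot [ m ] t
  L = leaf [ x ]
  shape : w ≡ x ∷ v ∷ʳ m
  shape = subst (λ y → w ≡ x ∷ v ∷ʳ y) last≡ S.shape
  m∉v : m ∉ v
  m∉v m∈v = Unique-++⇒∉ (x ∷ v) (subst Unique shape (Unique-rootLabel t uniq)) (there m∈v) (here refl)

module NodeCases (m : ℕ) (w : Word) (l r : Tree) (ao : AllNodes IsOddUnimodal (node w l r))
                 (uniq : Unique (letters (node w l r))) (m∉w : m ∉ w) where

  open ≡-Reasoning

  private
    ow = proj₁ ao
    al = proj₁ (proj₂ ao)
    ar = proj₂ (proj₂ ao)

    m∉root : ∀ {w′} (t : Tree) → m ∈ letters t → Unique (w′ ++ letters t) → m ∉ w′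
    m∉root {w′} t m∈t u m∈w′ = Unique-++⇒∉ w′ u m∈w′ m∈t

    root≢ : ∀ {w′} → m ∉ w′ → w′ ≢ [ m ]
    root≢ m∉w′ refl = m∉w′ (here refl)

  descend-left : ∀ {l′} → m ∈ letters l → IsφImage m l l′ → IsφImage m (node w l r) (node w l′ r)
  descend-left {l′} m∈l I = record
    { letters↭ = ++⁺ˡ w (++⁺ʳ (letters r) I.letters↭)
    ; oddUnimodal = ow , I.oddUnimodal , ar
    ; root≢ = root≢ m∉w
    ; inverse = begin
        φ m (node w l′ r)   ≡⟨ φ-node-left m w l′ r (proj₁ ow) m∉w (∈-resp-↭ (↭-sym I.letters↭) m∈l) ⟩
        φ-left m w l′ r     ≡⟨ φ-left-descend m w l′ r I.root≢ ⟩
        node w (φ m l′) r   ≡⟨ cong (λ t → node w t r) I.inverse ⟩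
        node w l r          ∎
    ; differByOne = DifferByOne-left (internalNodes r) I.differByOne }
    where module I = IsφImage I

  descend-right : ∀ {r′} → m ∉ letters l → IsφImage m r r′ → IsφImage m (node w l r) (node w l r′)
  descend-right {r′} m∉l I = record
    { letters↭ = ++⁺ˡ w (++⁺ˡ (letters l) I.letters↭)
    ; oddUnimodal = ow , al , I.oddUnimodal
    ; root≢ = root≢ m∉w
    ; inverse = begin
        φ m (node w l r′)   ≡⟨ φ-node-right m w l r′ (proj₁ ow) m∉w m∉l ⟩
        φ-right m w l r′    ≡⟨ φ-right-descend m w l r′ I.root≢ ⟩
        node w l (φ m r′)   ≡⟨ cong (node w l) I.inverse ⟩
        node w l r          ∎
    ; differByOne = DifferByOne-right (internalNodes l) I.differByOne }
    where module I = IsφImage I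

  transfer-right : m ∈ letters l → rootLabel l ≡ [ m ] → ¬ Extendsʳ w r → Increasing r →
    IsφImage m (node w l r) (node (proj₁ (transferʳ w r)) l (proj₂ (transferʳ w r)))
  transfer-right m∈l root≡ ¬ext ir = record
    { letters↭ = letters↭
    ; oddUnimodal = T.oddUnimodal , al , Increasing⇒AllNodes r′ T.increasing
    ; root≢ = root≢ m∉w′
    ; inverse = begin
        φ m (node w′ l r′)   ≡⟨ φ-node-left m w′ l r′ (proj₁ T.oddUnimodal) m∉w′ m∈l ⟩
        φ-left m w′ l r′     ≡⟨ φ-left-transfer m w′ l r′ root≡ T.¬extends T.increasing ⟩
        node (proj₁ (transferʳ w′ r′)) l (proj₂ (transferʳ w′ r′)) ≡⟨ cong (λ (v , s) → node v l s) T.inverse ⟩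
        node w l r           ∎
    ; differByOne = DifferByOne-right (internalNodes l) T.differByOne }
    where
    T = transferʳ-correct w r ow ir (Unique-++⁻ʳ (letters l) (Unique-resp-↭ (++-swapˡ w (letters l) (letters r)) uniq)) ¬ext
    module T = IsTransfer T
    w′ = proj₁ (transferʳ w r)
    r′ = proj₂ (transferʳ w r)
    letters↭ : w′ ++ letters l ++ letters r′ ↭ w ++ letters l ++ letters r
    letters↭ = ↭-trans (++-swapˡ w′ (letters l) (letters r′))
      (↭-trans (++⁺ˡ (letters l) T.letters↭) (++-swapˡ (letters l) w (letters r)))
    m∉w′ : m ∉ w′
    m∉w′ = m∉root l m∈l (Unique-++⁻ˡ (w′ ++ letters l)
             (subst Unique (sym (++-assoc w′ (letters l) (letters r′))) (Unique-resp-↭ (↭-sym letters↭) uniq)))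

  transfer-left : m ∈ letters r → rootLabel r ≡ [ m ] → ¬ Extendsˡ w l → Increasing l →
    IsφImage m (node w l r) (node (proj₁ (transferˡ w l)) (proj₂ (transferˡ w l)) r)
  transfer-left m∈r root≡ ¬ext il = record
    { letters↭ = letters↭
    ; oddUnimodal = T.oddUnimodal , Increasing⇒AllNodes l′ T.increasing , ar
    ; root≢ = root≢ m∉w′
    ; inverse = begin
        φ m (node w′ l′ r)   ≡⟨ φ-node-right m w′ l′ r (proj₁ T.oddUnimodal) m∉w′ m∉l′ ⟩
        φ-right m w′ l′ r    ≡⟨ φ-right-transfer m w′ l′ r root≡ T.¬extends T.increasing ⟩
        node (proj₁ (transferˡ w′ l′)) (proj₂ (transferˡ w′ l′)) r ≡⟨ cong (λ (v , s) → node v s r) T.inverse ⟩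
        node w l r           ∎
    ; differByOne = DifferByOne-left (internalNodes r) T.differByOne }
    where
    T = transferˡ-correct w l ow il (Unique-++⁻ˡ (w ++ letters l) (subst Unique (sym (++-assoc w (letters l) (letters r))) uniq)) ¬ext
    module T = IsTransfer T
    w′ = proj₁ (transferˡ w l)
    l′ = proj₂ (transferˡ w l)
    letters↭ : w′ ++ letters l′ ++ letters r ↭ w ++ letters l ++ letters r
    letters↭ = subst₂ _↭_ (++-assoc w′ (letters l′) (letters r)) (++-assoc w (letters l) (letters r))
      (++⁺ʳ (letters r) T.letters↭)
    uniq′ : Unique (w′ ++ letters l′ ++ letters r)
    uniq′ = Unique-resp-↭ (↭-sym letters↭) uniq
    m∉w′ : m ∉ w′
    m∉w′ m∈w′ = Unique-++⇒∉ w′ uniq′ m∈w′ (∈-++⁺ʳ (letters l′) m∈r)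
    m∉l′ : m ∉ letters l′
    m∉l′ m∈l′ = Unique-++⇒∉ (letters l′) (Unique-++⁻ʳ w′ uniq′) m∈l′ m∈r

  κ-right : m ∈ letters l → rootLabel l ≡ [ m ] → ¬ Increasing r → κ-Correct r → IsφImage m (node w l r) (node w l (κ r))
  κ-right m∈l root≡ ¬ir K = record
    { letters↭ = ++⁺ˡ w (++⁺ˡ (letters l) K.letters↭)
    ; oddUnimodal = ow , al , K.oddUnimodal
    ; root≢ = root≢ m∉w
    ; inverse = begin
        φ m (node w l (κ r))   ≡⟨ φ-node-left m w l (κ r) (proj₁ ow) m∉w m∈l ⟩
        φ-left m w l (κ r)     ≡⟨ φ-left-κ m w l (κ r) root≡ (κ-Correct⇒¬Increasing K ¬ir) ⟩
        node w l (κ (κ r))     ≡⟨ cong (node w l) K.involutive ⟩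
        node w l r             ∎
    ; differByOne = DifferByOne-right (internalNodes l) (K.differByOne ¬ir) }
    where module K = κ-Correct K

  κ-left : m ∉ letters l → rootLabel r ≡ [ m ] → ¬ Increasing l → κ-Correct l → IsφImage m (node w l r) (node w (κ l) r)
  κ-left m∉l root≡ ¬il K = record
    { letters↭ = ++⁺ˡ w (++⁺ʳ (letters r) K.letters↭)
    ; oddUnimodal = ow , K.oddUnimodal , ar
    ; root≢ = root≢ m∉w
    ; inverse = begin
        φ m (node w (κ l) r)   ≡⟨ φ-node-right m w (κ l) r (proj₁ ow) m∉w (m∉l ∘ ∈-resp-↭ K.letters↭) ⟩
        φ-right m w (κ l) r    ≡⟨ φ-right-κ m w (κ l) r root≡ (κ-Correct⇒¬Increasing K ¬il) ⟩
        node w (κ (κ l)) r     ≡⟨ cong (λ t → node w t r) K.involutive ⟩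
        node w l r             ∎
    ; differByOne = DifferByOne-left (internalNodes r) (K.differByOne ¬il) }
    where module K = κ-Correct K

record IsκImage (m : ℕ) (t u : Tree) : Set where
  field
    letters↭ : letters u ↭ letters t
    oddUnimodal : AllNodes IsOddUnimodal u
    inverse : κ-at m u ≡ t
    differByOne : ¬ Increasing t → DifferByOne (internalNodes u) (internalNodes t)

κ-Correct-intro : ∀ {m} t → IsMinimum m (letters t) → IsκImage m t (κ-at m t) → κ-Correct t
κ-Correct-intro {m} t min I = record
  { letters↭ = subst (λ u → letters u ↭ letters t) (sym κ≡) I.letters↭
  ; oddUnimodal = subst (AllNodes IsOddUnimodal) (sym κ≡) I.oddUnimodal
  ; involutive = begin
      κ (κ t)             ≡⟨ cong κ κ≡ ⟩
      κ (κ-at m t)        ≡⟨ κ≡κ-at (κ-at m t) (IsMinimum-resp-↭ (↭-sym I.letters↭) min) ⟩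
      κ-at m (κ-at m t)   ≡⟨ I.inverse ⟩
      t                   ∎
  ; differByOne = subst (λ u → ¬ Increasing t → DifferByOne (internalNodes u) (internalNodes t)) (sym κ≡) I.differByOne }
  where
  open ≡-Reasoning
  module I = IsκImage I
  κ≡ = κ≡κ-at t min

IsφImage⇒IsκImage : ∀ {m t u} → IsφImage m t u → IsκImage m t u
IsφImage⇒IsκImage {m} {u = u} I = record
  { letters↭ = I.letters↭
  ; oddUnimodal = I.oddUnimodal
  ; inverse = trans (κ-at-unrooted m u I.root≢) I.inverse
  ; differByOne = λ _ → I.differByOne }
  where module I = IsφImage I

IsκImage-increasing : ∀ {m} t → Increasing t → rootLabel t ≡ [ m ] → IsκImage m t t
IsκImage-increasing t it root≡ = record
  { letters↭ = ↭-refl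
  ; oddUnimodal = Increasing⇒AllNodes t it
  ; inverse = trans (κ-at-rooted _ t root≡) (κ-rooted-increasing t it)
  ; differByOne = λ ¬it → ⊥-elim (¬it it) }

module RootedCases (m : ℕ) (l r : Tree) (ao : AllNodes IsOddUnimodal (node [ m ] l r)) where

  open ≡-Reasoning

  κ-left : ¬ Increasing l → κ-Correct l → IsκImage m (node [ m ] l r) (node [ m ] (κ l) r)
  κ-left ¬il K = record
    { letters↭ = ++⁺ˡ [ m ] (++⁺ʳ (letters r) K.letters↭)
    ; oddUnimodal = proj₁ ao , K.oddUnimodal , proj₂ (proj₂ ao)
    ; inverse = begin
        κ-at m (node [ m ] (κ l) r)    ≡⟨ κ-at-rooted m _ refl ⟩
        κ-rooted (node [ m ] (κ l) r)  ≡⟨ κ-rooted-left [ m ] (κ l) r (κ-Correct⇒¬Increasing K ¬il) ⟩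
        node [ m ] (κ (κ l)) r         ≡⟨ cong (λ t → node [ m ] t r) K.involutive ⟩
        node [ m ] l r                 ∎
    ; differByOne = λ _ → DifferByOne-left (internalNodes r) (K.differByOne ¬il) }
    where module K = κ-Correct K

  κ-right : Increasing l → ¬ Increasing r → κ-Correct r → IsκImage m (node [ m ] l r) (node [ m ] l (κ r))
  κ-right il ¬ir K = record
    { letters↭ = ++⁺ˡ [ m ] (++⁺ˡ (letters l) K.letters↭)
    ; oddUnimodal = proj₁ ao , proj₁ (proj₂ ao) , K.oddUnimodal
    ; inverse = begin
        κ-at m (node [ m ] l (κ r))    ≡⟨ κ-at-rooted m _ refl ⟩
        κ-rooted (node [ m ] l (κ r))  ≡⟨ κ-rooted-right [ m ] l (κ r) il (κ-Correct⇒¬Increasing K ¬ir) ⟩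
        node [ m ] l (κ (κ r))         ≡⟨ cong (node [ m ] l) K.involutive ⟩
        node [ m ] l r                 ∎
    ; differByOne = λ _ → DifferByOne-right (internalNodes l) (K.differByOne ¬ir) }
    where module K = κ-Correct K

mutual
  κ-correct : ∀ t → AllNodes IsOddUnimodal t → Unique (letters t) → κ-Correct t
  κ-correct t ao uniq = κ-Correct-intro t min (κ-at-correct t ao uniq min)
    where min = IsMinimum-minimum (letters≢[] t ao)

  κ-at-correct : ∀ {m} t → AllNodes IsOddUnimodal t → Unique (letters t) → IsMinimum m (letters t) →
    IsκImage m t (κ-at m t)
  κ-at-correct {m} t ao uniq min with rootLabel t ≟ʷ [ m ]
  ... | yes root≡ = κ-rooted-correct t ao uniq min root≡
  ... | no root≢ = IsφImage⇒IsκImage (φ-correct m t ao uniq min root≢)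

  κ-rooted-correct : ∀ {m} t → AllNodes IsOddUnimodal t → Unique (letters t) → IsMinimum m (letters t) →
    rootLabel t ≡ [ m ] → IsκImage m t (κ-rooted t)
  κ-rooted-correct (leaf _) _ _ _ refl = IsκImage-increasing (leaf _) tt refl
  κ-rooted-correct {m} (node _ l r) ao uniq min refl with increasing? l | increasing? r
  ... | no ¬il | _ = RootedCases.κ-left m l r ao ¬il (κ-correct l (proj₁ (proj₂ ao)) (Unique-left [ m ] l r uniq))
  ... | yes il | no ¬ir = RootedCases.κ-right m l r ao il ¬ir (κ-correct r (proj₂ (proj₂ ao)) (Unique-right [ m ] l r uniq))
  ... | yes il | yes ir = IsκImage-increasing _ (Increasing-node m l r uniq (proj₂ min) il ir) refl

  φ-correct : ∀ m t → AllNodes IsOddUnimodal t → Unique (letters t) → IsMinimum m (letters t) →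
    rootLabel t ≢ [ m ] → IsφImage m t (φ m t)
  φ-correct m t ao uniq min root≢ with first (rootLabel t) ≟ m | last (rootLabel t) ≟ m
  ... | yes first≡ | _ = splitˡ-correct m t ao uniq root≢ first≡
  ... | no first≢ | yes last≡ = splitʳ-correct m t ao uniq root≢ first≢ last≡
  ... | no first≢ | no last≢ = φ-below-correct m t ao uniq min m∉root
    where
    m∉root : m ∉ rootLabel t
    m∉root m∈ with IsUnimodal-min-at-end (proj₁ (AllNodes-rootLabel t ao)) m∈
                     (AllP.++⁻ˡ (rootLabel t) (subst (All (m ≤_)) (letters-rootLabel t) (proj₂ min)))
    ... | inj₁ first≡ = first≢ first≡
    ... | inj₂ last≡ = last≢ last≡

  φ-below-correct : ∀ m t → AllNodes IsOddUnimodal t → Unique (letters t) → IsMinimum m (letters t) →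
    m ∉ rootLabel t → IsφImage m t (φ-below m t)
  φ-below-correct m (leaf w) _ _ (m∈w , _) m∉w = ⊥-elim (m∉w m∈w)
  φ-below-correct m (node w l r) ao uniq min m∉w with m ∈? letters l
  ... | yes m∈l = φ-left-correct m w l r ao uniq min m∉w m∈l
  ... | no m∉l = φ-right-correct m w l r ao uniq min m∉w m∉l (∈-right w l r (proj₁ min) m∉w m∉l)

  φ-left-correct : ∀ m w l r → AllNodes IsOddUnimodal (node w l r) → Unique (letters (node w l r)) →
    IsMinimum m (letters (node w l r)) → m ∉ w → m ∈ letters l → IsφImage m (node w l r) (φ-left m w l r)
  φ-left-correct m w l r ao uniq min m∉w m∈l with rootLabel l ≟ʷ [ m ] | extendsʳ? w r | increasing? r
  ... | no root≢ | _ | _ = NodeCases.descend-left m w l r ao uniq m∉w m∈l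
        (φ-correct m l (proj₁ (proj₂ ao)) (Unique-left w l r uniq) (IsMinimum-left w l r m∈l min) root≢)
  ... | yes root≡ | yes (extendsʳ wz) | _ = mergeˡ-correct m w l _ ao min m∉w root≡ wz
  ... | yes root≡ | no ¬ext | yes ir = NodeCases.transfer-right m w l r ao uniq m∉w m∈l root≡ ¬ext ir
  ... | yes root≡ | no ¬ext | no ¬ir = NodeCases.κ-right m w l r ao uniq m∉w m∈l root≡ ¬ir
        (κ-correct r (proj₂ (proj₂ ao)) (Unique-right w l r uniq))

  φ-right-correct : ∀ m w l r → AllNodes IsOddUnimodal (node w l r) → Unique (letters (node w l r)) →
    IsMinimum m (letters (node w l r)) → m ∉ w → m ∉ letters l → m ∈ letters r → IsφImage m (node w l r) (φ-right m w l r)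
  φ-right-correct m w l r ao uniq min m∉w m∉l m∈r with rootLabel r ≟ʷ [ m ] | extendsˡ? w l | increasing? l
  ... | no root≢ | _ | _ = NodeCases.descend-right m w l r ao uniq m∉w m∉l
        (φ-correct m r (proj₂ (proj₂ ao)) (Unique-right w l r uniq) (IsMinimum-right w l r m∈r min) root≢)
  ... | yes root≡ | yes (extendsˡ xw) | _ = mergeʳ-correct m w _ r ao min m∉w (λ x≡m → m∉l (here (sym x≡m))) root≡ xw
  ... | yes root≡ | no ¬ext | yes il = NodeCases.transfer-left m w l r ao uniq m∉w m∈r root≡ ¬ext il
  ... | yes root≡ | no ¬ext | no ¬il = NodeCases.κ-left m w l r ao uniq m∉w m∉l root≡ ¬il
        (κ-correct l (proj₁ (proj₂ ao)) (Unique-left w l r uniq))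

LB-κ-Correct : ∀ n (T : LB n) → κ-Correct (proj₁ T)
LB-κ-Correct n (T , labels , T↭) = κ-correct T (AllNodes-OddUnimodal⇒ T labels) (Unique-resp-↭ (↭-sym T↭) (Unique-interval _))

κ-LB : ∀ n → LB n → LB n
κ-LB n T = κ (proj₁ T) , AllNodes-OddUnimodal⇐ (κ (proj₁ T)) K.oddUnimodal (Unique-resp-↭ (↭-sym κT↭) (Unique-interval _)) , κT↭
  where
  module K = κ-Correct (LB-κ-Correct n T)
  κT↭ = ↭-trans K.letters↭ (proj₂ (proj₂ T))

κ-fixed⇔Increasing : ∀ t → κ-Correct t → (κ t ≡ t) ⇔ Increasing t
κ-fixed⇔Increasing t K = mk⇔ fixed⇒increasing (κ-fixes-increasing t)
  where
  fixed⇒increasing : κ t ≡ t → Increasing t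
  fixed⇒increasing fixed with increasing? t
  ... | yes it = it
  ... | no ¬it = ⊥-elim (DifferByOne-irrefl
                   (subst (λ u → DifferByOne (internalNodes u) (internalNodes t)) fixed (κ-Correct.differByOne K ¬it)))

DifferByOne⇒signs-cancel : ∀ {a b} → DifferByOne a b → -1ℤ ^ b + -1ℤ ^ a ≡ 0ℤ
DifferByOne⇒signs-cancel {b = b} (inj₁ refl) = trans (cong (-1ℤ ^ b +_) (ℤ.-1*i≡-i (-1ℤ ^ b))) (ℤ.+-inverseʳ (-1ℤ ^ b))
DifferByOne⇒signs-cancel {a} (inj₂ refl) =
  trans (ℤ.+-comm (-1ℤ ^ suc a) (-1ℤ ^ a)) (DifferByOne⇒signs-cancel {suc a} {a} (inj₁ refl))

κ-flips-sign : ∀ t → κ-Correct t → ¬ Increasing t → -1ℤ ^ h t + -1ℤ ^ h (κ t) ≡ 0ℤ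
κ-flips-sign t K ¬it rewrite h≡internalNodes t | h≡internalNodes (κ t) =
  DifferByOne⇒signs-cancel (κ-Correct.differByOne K ¬it)

lemma3p1 : (n : ℕ) → Σ (LB n → LB n) λ κ →
    ((T : LB n) → proj₁ (κ (κ T)) ≡ proj₁ T)
    × ((T : LB n) → (proj₁ (κ T) ≡ proj₁ T) ⇔ Increasing (proj₁ T))
    × ((T : LB n) → ¬ Increasing (proj₁ T) →
        (-1ℤ ^ h (proj₁ T)) + (-1ℤ ^ h (proj₁ (κ T))) ≡ 0ℤ)
lemma3p1 n =
  κ-LB n ,
  (λ T → κ-Correct.involutive (LB-κ-Correct n T)) ,
  (λ T → κ-fixed⇔Increasing (proj₁ T) (LB-κ-Correct n T)) ,
  (λ T → κ-flips-sign (proj₁ T) (LB-κ-Correct n T))
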